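{- Let $q$ be a prime power and $n\ge1$. Then: (i) $B_n+E_n=q^n/n$; (ii) $A_n=O(q^{n/2}/n)$; (iii) $B_n=O(q^{n/2}/n)$; (iv) $E_n=q^n/n+O(q^{n/2}/n)$; (v) if $q>5$ then $E_n>2A_n+4$; (vi) there exists an absolute constant $c>0$ such that $\frac{E_n}{2}-2A_n-\frac q2-1>c(A_n+E_n)$ whenever $q>11$ and $n>1$. The implied constants are absolute.
   Context: $E_d$ is the number of monic irreducible polynomials of degree $d$ over $\mathbb F_q$; $A_n=\sum_{d\mid n,\,d<n}E_d$ and $B_n=\sum_{d\mid n,\,d<n}E_d\,d/n$. -}

module Defs where

open import Level using (0ℓ)
open import Data.Nat using (ℕ; zero; suc; _+_; _*_; _≤_; _<_; _≤?_; z≤n; s≤s)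
import Data.Nat.Properties
open Data.Nat.Properties using (_≟_)
open import Data.Nat.Divisibility using (_∣_; _∣?_)
open import Data.Fin using (Fin; toℕ; fromℕ<)
open import Data.Fin.Properties using (any?; toℕ-fromℕ<; toℕ<n) renaming (_≟_ to _≟ᶠ_)
open import Data.List using (List; []; _∷_; [_]; map; _++_; length; filter; upTo; allFin; concatMap)
open import Data.List.Properties using (≡-dec)
open import Data.Nat.ListAction using (sum)
open import Data.Vec using (Vec; []; _∷_; toList)
open import Data.Product using (Σ; ∃; _×_; _,_; proj₁; proj₂)
open import Relation.Nullary using (Dec; yes; no; ¬_; ¬?)
open import Relation.Nullary.Decidable using (_×-dec_)
open import Relation.Binary.PropositionalEquality using (_≡_; _≢_; refl; sym; trans; cong; subst)
open import Relation.Binary.Definitions using (DecidableEquality)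
open import Algebra.Structures using (IsCommutativeRing)
open import Function.Bundles using (_↔_; Inverse)

record FiniteField : Set₁ where
  field
    Carrier : Set
    _+F_ _*F_ : Carrier → Carrier → Carrier
    -F_ : Carrier → Carrier
    0F 1F : Carrier
    isCommutativeRing : IsCommutativeRing _≡_ _+F_ _*F_ -F_ 0F 1F
    1≢0 : 1F ≢ 0F
    inverse : ∀ x → x ≢ 0F → ∃ λ y → x *F y ≡ 1F
    size : ℕ
    enum : Carrier ↔ Fin size

card : FiniteField → ℕ
card = FiniteField.size

module Poly (F : FiniteField) where
  open FiniteField F
  open Inverse enum using (to; from; strictlyInverseʳ)

  -- polynomials as coefficient lists, constant coefficient first
  _⊕_ : List Carrier → List Carrier → List Carrier
  [] ⊕ ys = ys
  (x ∷ xs) ⊕ [] = x ∷ xs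
  (x ∷ xs) ⊕ (y ∷ ys) = (x +F y) ∷ (xs ⊕ ys)

  _⊛_ : List Carrier → List Carrier → List Carrier
  [] ⊛ ys = []
  (x ∷ xs) ⊛ ys = map (x *F_) ys ⊕ (0F ∷ (xs ⊛ ys))

  -- the monic polynomial of degree d whose lower coefficients are v
  -- (v = (c₀ , … , c_{d-1}) gives  c₀ + c₁ X + … + c_{d-1} X^{d-1} + X^d)
  monic : ∀ {d} → Vec Carrier d → List Carrier
  monic v = toList v ++ [ 1F ]

  Factorization : (d : ℕ) → Vec Carrier d → Set
  Factorization d v =
    Σ ℕ λ a → Σ ℕ λ b → (suc a + suc b ≡ d) ×
      (Σ (Vec Carrier (suc a)) λ g → Σ (Vec Carrier (suc b)) λ h →
         monic g ⊛ monic h ≡ monic v)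

  Irreducible : (d : ℕ) → Vec Carrier d → Set
  Irreducible d v = (1 ≤ d) × ¬ Factorization d v

  _≟C_ : DecidableEquality Carrier
  x ≟C y with to x ≟ᶠ to y
  ... | yes p = yes (trans (sym (strictlyInverseʳ x)) (trans (cong from p) (strictlyInverseʳ y)))
  ... | no ¬p = no λ { refl → ¬p refl }

  decΣC : (P : Carrier → Set) → (∀ x → Dec (P x)) → Dec (Σ Carrier P)
  decΣC P P? with any? (λ i → P? (from i))
  ... | yes (i , p) = yes (from i , p)
  ... | no ¬p = no λ { (x , px) → ¬p (to x , subst P (sym (strictlyInverseʳ x)) px) }

  decΣVec : ∀ d (P : Vec Carrier d → Set) → (∀ v → Dec (P v)) → Dec (Σ (Vec Carrier d) P)
  decΣVec zero P P? with P? []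
  ... | yes p = yes ([] , p)
  ... | no ¬p = no λ { ([] , p) → ¬p p }
  decΣVec (suc d) P P? with decΣC (λ x → Σ (Vec Carrier d) λ v → P (x ∷ v))
                                 (λ x → decΣVec d (λ v → P (x ∷ v)) (λ v → P? (x ∷ v)))
  ... | yes (x , v , p) = yes (x ∷ v , p)
  ... | no ¬p = no λ { (x ∷ v , p) → ¬p (x , v , p) }

  decΣℕ : ∀ d (P : ℕ → Set) → (∀ a → P a → a < d) → (∀ a → Dec (P a)) → Dec (Σ ℕ P)
  decΣℕ d P bnd P? with any? {n = d} (λ i → P? (toℕ i))
  ... | yes (i , p) = yes (toℕ i , p)
  ... | no ¬p = no λ { (a , pa) → ¬p (fromℕ< (bnd a pa) , subst P (sym (toℕ-fromℕ< (bnd a pa))) pa) }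

  private
    bndA : ∀ {d a b} → suc a + suc b ≡ d → a < d
    bndA {a = a} {b} refl = s≤s (Data.Nat.Properties.m≤m+n a (suc b))
    bndB : ∀ {d a b} → suc a + suc b ≡ d → b < d
    bndB {a = a} {b} refl = s≤s (Data.Nat.Properties.≤-trans (Data.Nat.Properties.n≤1+n b) (Data.Nat.Properties.m≤n+m (suc b) a))

  factorization? : ∀ d v → Dec (Factorization d v)
  factorization? d v =
    decΣℕ d _ (λ a → λ { (b , e , _) → bndA e }) λ a →
    decΣℕ d _ (λ b → λ { (e , _) → bndB e }) λ b →
    (suc a + suc b ≟ d) ×-dec
    decΣVec (suc a) _ (λ g → decΣVec (suc b) _ (λ h →
      ≡-dec _≟C_ (monic g ⊛ monic h) (monic v)))

  irreducible? : ∀ d v → Dec (Irreducible d v)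
  irreducible? d v = (1 ≤? d) ×-dec ¬? (factorization? d v)

  allC : List Carrier
  allC = map from (allFin size)

  allVecs : ∀ d → List (Vec Carrier d)
  allVecs zero = [ [] ]
  allVecs (suc d) = concatMap (λ x → map (x ∷_) (allVecs d)) allC

E : FiniteField → ℕ → ℕ
E F d = length (filter (irreducible? d) (allVecs d))
  where open Poly F

properDivisors : ℕ → List ℕ
properDivisors n = filter (λ d → (1 ≤? d) ×-dec (d ∣? n)) (upTo n)

A : FiniteField → ℕ → ℕ
A F n = sum (map (E F) (properDivisors n))

-- n · B n = Σ_{d ∣ n, d < n} d · E d   (B n itself is this divided by n)
nB : FiniteField → ℕ → ℕ
nB F n = sum (map (λ d → d * E F d) (properDivisors n))

-- For a monic polynomial f, Σ_P deg P · v_P(f) over the monic irreducible P equals deg f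
-- (unique factorisation, a consequence of Euclid's lemma). Summing over the q^n monic f of
-- degree n, and counting for each power P^j its q^(n - j deg P) monic multiples of degree n,
-- gives an identity whose difference between n and n + 1 is Gauss's formula
-- Σ_{d ∣ n} d E_d = q^n, which is (i). Hence d E_d ≤ q^d, and since every proper divisor of n
-- is at most n / 2, nB_n ≤ 2 q^(n/2) and n A_n ≤ 12 q^(n/2), giving (ii)-(iv). For n ≥ 3 the
-- remaining term n E_n = q^n - nB_n dominates, which gives (v) and (vi); for n = 2 one uses
-- E_2 = (q^2 - q) / 2 directly, and (v) then needs q ≠ 6: no field has six elements.

module Submission where

open import Defs
open import Data.Nat using (ℕ; zero; suc; _+_; _*_; _∸_; _^_; _≤_; _<_; _≤?_; _<?_; z≤n; s≤s; _⊔_; ⌊_/2⌋; ⌈_/2⌉; NonZero; >-nonZero)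
import Data.Nat.Properties as ℕ
import Data.Nat.Divisibility as Div
open import Data.Nat.ListAction using (sum)
open import Data.Nat.Tactic.RingSolver using (solve-∀)
open import Data.List using (List; []; _∷_; [_]; map; _++_; length; filter; concatMap; upTo; applyUpTo; allFin)
import Data.List.Properties as List
open import Data.Vec using (Vec; toList; fromList)
import Data.Vec.Properties as Vec
open import Data.Fin as Fin using (Fin; toℕ; fromℕ<)
import Data.Fin.Properties as Fin
open import Data.Product using (Σ; _×_; _,_; proj₁; proj₂)
open import Data.Sum using (_⊎_; inj₁; inj₂)
open import Data.Empty using (⊥-elim)
open import Relation.Nullary using (Dec; yes; no; ¬_; ¬?)
open import Relation.Nullary.Decidable using (map′; _×-dec_)
open import Relation.Binary.PropositionalEquality hiding ([_])
open import Relation.Binary.Definitions using (DecidableEquality; tri<; tri≈; tri>)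
open import Function.Base using (_∘_)
open import Function.Bundles using (Inverse)
open import Algebra.Bundles using (CommutativeRing)
import Algebra.Properties.Ring as RingProperties
import Algebra.Properties.CommutativeSemigroup as CommutativeSemigroupProperties
import Algebra.Properties.Semiring.Mult as SemiringMult

-- Finite sums

private variable X Y : Set

∑ : List X → (X → ℕ) → ℕ
∑ [] f = 0
∑ (x ∷ xs) f = f x + ∑ xs f

∑≡sum∘map : ∀ (xs : List X) f → ∑ xs f ≡ sum (map f xs)
∑≡sum∘map [] f = refl
∑≡sum∘map (x ∷ xs) f = cong (f x +_) (∑≡sum∘map xs f)

∑-cong : ∀ (xs : List X) {f g} → (∀ x → f x ≡ g x) → ∑ xs f ≡ ∑ xs g
∑-cong [] e = refl
∑-cong (x ∷ xs) e = cong₂ _+_ (e x) (∑-cong xs e)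

∑-zero : ∀ (xs : List X) {f} → (∀ x → f x ≡ 0) → ∑ xs f ≡ 0
∑-zero [] e = refl
∑-zero (x ∷ xs) e = cong₂ _+_ (e x) (∑-zero xs e)

∑-const : ∀ (xs : List X) c → ∑ xs (λ _ → c) ≡ length xs * c
∑-const [] c = refl
∑-const (x ∷ xs) c = cong (c +_) (∑-const xs c)

length≡∑1 : ∀ (xs : List X) → length xs ≡ ∑ xs (λ _ → 1)
length≡∑1 xs = sym (trans (∑-const xs 1) (ℕ.*-identityʳ _))

∑-distrib-+ : ∀ (xs : List X) f g → ∑ xs (λ x → f x + g x) ≡ ∑ xs f + ∑ xs g
∑-distrib-+ [] f g = refl
∑-distrib-+ (x ∷ xs) f g = trans (cong (f x + g x +_) (∑-distrib-+ xs f g)) (interchange (f x) (g x) _ _)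
  where
  interchange : ∀ a b c d → (a + b) + (c + d) ≡ (a + c) + (b + d)
  interchange = solve-∀

∑-*ˡ : ∀ (xs : List X) c f → ∑ xs (λ x → c * f x) ≡ c * ∑ xs f
∑-*ˡ [] c f = sym (ℕ.*-zeroʳ c)
∑-*ˡ (x ∷ xs) c f = trans (cong (c * f x +_) (∑-*ˡ xs c f)) (sym (ℕ.*-distribˡ-+ c (f x) _))

∑-++ : ∀ (xs ys : List X) f → ∑ (xs ++ ys) f ≡ ∑ xs f + ∑ ys f
∑-++ [] ys f = refl
∑-++ (x ∷ xs) ys f = trans (cong (f x +_) (∑-++ xs ys f)) (sym (ℕ.+-assoc (f x) _ _))

∑-map : ∀ (xs : List X) (g : X → Y) f → ∑ (map g xs) f ≡ ∑ xs (λ x → f (g x))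
∑-map [] g f = refl
∑-map (x ∷ xs) g f = cong (f (g x) +_) (∑-map xs g f)

∑-concatMap : ∀ (xs : List X) (h : X → List Y) f → ∑ (concatMap h xs) f ≡ ∑ xs (λ x → ∑ (h x) f)
∑-concatMap [] h f = refl
∑-concatMap (x ∷ xs) h f = trans (∑-++ (h x) (concatMap h xs) f) (cong (∑ (h x) f +_) (∑-concatMap xs h f))

∑-comm : ∀ (xs : List X) (ys : List Y) (f : X → Y → ℕ) → ∑ xs (λ x → ∑ ys (f x)) ≡ ∑ ys (λ y → ∑ xs (λ x → f x y))
∑-comm [] ys f = sym (∑-zero ys (λ _ → refl))
∑-comm (x ∷ xs) ys f = trans (cong (∑ ys (f x) +_) (∑-comm xs ys f)) (sym (∑-distrib-+ ys (f x) _))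

𝟙 : ∀ {P : Set} → Dec P → ℕ
𝟙 (yes _) = 1
𝟙 (no _) = 0

𝟙-yes : ∀ {P : Set} (P? : Dec P) → P → 𝟙 P? ≡ 1
𝟙-yes (yes _) _ = refl
𝟙-yes (no ¬p) p = ⊥-elim (¬p p)

𝟙-no : ∀ {P : Set} (P? : Dec P) → ¬ P → 𝟙 P? ≡ 0
𝟙-no (yes p) ¬p = ⊥-elim (¬p p)
𝟙-no (no _) _ = refl

𝟙-cong : ∀ {P Q : Set} (P? : Dec P) (Q? : Dec Q) → (P → Q) → (Q → P) → 𝟙 P? ≡ 𝟙 Q?
𝟙-cong (yes p) Q? f g = sym (𝟙-yes Q? (f p))
𝟙-cong (no ¬p) Q? f g = sym (𝟙-no Q? (λ q → ¬p (g q)))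

𝟙-× : ∀ {P Q : Set} (P? : Dec P) (Q? : Dec Q) → 𝟙 (P? ×-dec Q?) ≡ 𝟙 P? * 𝟙 Q?
𝟙-× (yes _) (yes _) = refl
𝟙-× (yes _) (no _) = refl
𝟙-× (no _) _ = refl

∑-𝟙-no : ∀ (xs : List X) {P : X → Set} (P? : ∀ x → Dec (P x)) → (∀ x → ¬ P x) → ∑ xs (λ x → 𝟙 (P? x)) ≡ 0
∑-𝟙-no xs P? ¬P = ∑-zero xs (λ x → 𝟙-no (P? x) (¬P x))

∑-filter : ∀ {P : X → Set} (P? : ∀ x → Dec (P x)) xs f → ∑ (filter P? xs) f ≡ ∑ xs (λ x → 𝟙 (P? x) * f x)
∑-filter P? [] f = refl
∑-filter P? (x ∷ xs) f with P? x
... | yes _ = cong₂ _+_ (sym (ℕ.*-identityˡ (f x))) (∑-filter P? xs f)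
... | no _ = ∑-filter P? xs f

∑-filter-cong : ∀ {P : X → Set} (P? : ∀ x → Dec (P x)) xs {f g} →
  (∀ x → P x → f x ≡ g x) → ∑ (filter P? xs) f ≡ ∑ (filter P? xs) g
∑-filter-cong P? [] h = refl
∑-filter-cong P? (x ∷ xs) h with P? x
... | yes p = cong₂ _+_ (h x p) (∑-filter-cong P? xs h)
... | no _ = ∑-filter-cong P? xs h

range : ℕ → List ℕ
range zero = []
range (suc n) = 0 ∷ map suc (range n)

upTo≡range : ∀ n → upTo n ≡ range n
upTo≡range n = trans (applyUpTo≡map n (λ j → j)) (List.map-id (range n))
  where
  applyUpTo≡map : ∀ n (g : ℕ → ℕ) → applyUpTo g n ≡ map g (range n)
  applyUpTo≡map zero g = refl
  applyUpTo≡map (suc n) g = cong (g 0 ∷_) (trans (applyUpTo≡map n (λ j → g (suc j))) (List.map-∘ (range n)))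

∑-range-suc : ∀ n f → ∑ (range (suc n)) f ≡ f 0 + ∑ (range n) (λ j → f (suc j))
∑-range-suc n f = cong (f 0 +_) (∑-map (range n) suc f)

∑-range-last : ∀ n f → ∑ (range (suc n)) f ≡ ∑ (range n) f + f n
∑-range-last zero f = ℕ.+-identityʳ (f 0)
∑-range-last (suc n) f = begin
  ∑ (range (suc (suc n))) f                           ≡⟨ ∑-range-suc (suc n) f ⟩
  f 0 + ∑ (range (suc n)) (λ j → f (suc j))           ≡⟨ cong (f 0 +_) (∑-range-last n (λ j → f (suc j))) ⟩
  f 0 + (∑ (range n) (λ j → f (suc j)) + f (suc n))   ≡⟨ sym (ℕ.+-assoc (f 0) _ _) ⟩
  (f 0 + ∑ (range n) (λ j → f (suc j))) + f (suc n)   ≡⟨ cong (_+ f (suc n)) (sym (∑-range-suc n f)) ⟩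
  ∑ (range (suc n)) f + f (suc n)                     ∎
  where open ≡-Reasoning

∑-range-cong : ∀ n {f g : ℕ → ℕ} → (∀ j → j < n → f j ≡ g j) → ∑ (range n) f ≡ ∑ (range n) g
∑-range-cong zero h = refl
∑-range-cong (suc n) {f} {g} h = begin
  ∑ (range (suc n)) f  ≡⟨ ∑-range-last n f ⟩
  ∑ (range n) f + f n  ≡⟨ cong₂ _+_ (∑-range-cong n (λ j j<n → h j (ℕ.m<n⇒m<1+n j<n))) (h n ℕ.≤-refl) ⟩
  ∑ (range n) g + g n  ≡⟨ sym (∑-range-last n g) ⟩
  ∑ (range (suc n)) g  ∎
  where open ≡-Reasoning

∑-range-mono : ∀ n {f g : ℕ → ℕ} → (∀ j → j < n → f j ≤ g j) → ∑ (range n) f ≤ ∑ (range n) g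
∑-range-mono zero h = z≤n
∑-range-mono (suc n) {f} {g} h = subst₂ _≤_ (sym (∑-range-last n f)) (sym (∑-range-last n g))
  (ℕ.+-mono-≤ (∑-range-mono n (λ j j<n → h j (ℕ.m<n⇒m<1+n j<n))) (h n ℕ.≤-refl))

∑-range-zero : ∀ n f → (∀ j → j < n → f j ≡ 0) → ∑ (range n) f ≡ 0
∑-range-zero n f h = trans (∑-range-cong n h) (∑-zero (range n) (λ _ → refl))

∑-range-truncate : ∀ k n (f : ℕ → ℕ) → k ≤ n → (∀ j → k ≤ j → f j ≡ 0) → ∑ (range n) f ≡ ∑ (range k) f
∑-range-truncate k zero f z≤n h = refl
∑-range-truncate k (suc n) f k≤1+n h with ℕ.m≤n⇒m<n∨m≡n k≤1+n
... | inj₂ refl = refl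
... | inj₁ (s≤s k≤n) =
  trans (∑-range-last n f) (trans (cong₂ _+_ (∑-range-truncate k n f k≤n h) (h n k≤n)) (ℕ.+-identityʳ _))

∑-range-delta : ∀ n k (f : ℕ → ℕ) → k < n → ∑ (range n) (λ j → 𝟙 (j ℕ.≟ k) * f j) ≡ f k
∑-range-delta n k f k<n = begin
  ∑ (range n) (λ j → 𝟙 (j ℕ.≟ k) * f j)               ≡⟨ ∑-range-truncate (suc k) n δf k<n beyond ⟩
  ∑ (range (suc k)) (λ j → 𝟙 (j ℕ.≟ k) * f j)         ≡⟨ ∑-range-last k δf ⟩
  ∑ (range k) (λ j → 𝟙 (j ℕ.≟ k) * f j) + 𝟙 (k ℕ.≟ k) * f k
    ≡⟨ cong₂ _+_ below (trans (cong (_* f k) (𝟙-yes (k ℕ.≟ k) refl)) (ℕ.*-identityˡ (f k))) ⟩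
  f k                                                  ∎
  where
  open ≡-Reasoning
  δf : ℕ → ℕ
  δf j = 𝟙 (j ℕ.≟ k) * f j
  beyond : ∀ j → suc k ≤ j → 𝟙 (j ℕ.≟ k) * f j ≡ 0
  beyond j k<j = cong (_* f j) (𝟙-no (j ℕ.≟ k) (λ j≡k → ℕ.<-irrefl (sym j≡k) k<j))
  below : ∑ (range k) (λ j → 𝟙 (j ℕ.≟ k) * f j) ≡ 0
  below = ∑-range-zero k δf (λ j j<k → cong (_* f j) (𝟙-no (j ℕ.≟ k) (λ j≡k → ℕ.<-irrefl j≡k j<k)))

∑-allFin-delta : ∀ n (k : Fin n) → ∑ (allFin n) (λ i → 𝟙 (i Fin.≟ k)) ≡ 1
∑-allFin-delta (suc n) k = trans (∑-allFin-suc n _) (split k)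
  where
  ∑-allFin-suc : ∀ n f → ∑ (allFin (suc n)) f ≡ f Fin.zero + ∑ (allFin n) (λ i → f (Fin.suc i))
  ∑-allFin-suc n f =
    cong (f Fin.zero +_) (trans (cong (λ xs → ∑ xs f) (sym (List.map-tabulate (λ i → i) Fin.suc))) (∑-map (allFin n) Fin.suc f))
  split : ∀ k → 𝟙 (Fin.zero Fin.≟ k) + ∑ (allFin n) (λ i → 𝟙 (Fin.suc i Fin.≟ k)) ≡ 1
  split Fin.zero = cong suc (∑-zero (allFin n) (λ _ → refl))
  split (Fin.suc k) =
    trans (∑-cong (allFin n) (λ i → 𝟙-cong (Fin.suc i Fin.≟ Fin.suc k) (i Fin.≟ k) Fin.suc-injective (cong Fin.suc)))
          (∑-allFin-delta n k)

∑-range-𝟙≤ : ∀ n h (f : ℕ → ℕ) → h < n → ∑ (range n) (λ d → 𝟙 (d ≤? h) * f d) ≡ ∑ (range (suc h)) f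
∑-range-𝟙≤ n h f h<n = begin
  ∑ (range n) (λ d → 𝟙 (d ≤? h) * f d)
    ≡⟨ ∑-range-truncate (suc h) n _ h<n (λ d h<d → cong (_* f d) (𝟙-no (d ≤? h) (ℕ.<⇒≱ h<d))) ⟩
  ∑ (range (suc h)) (λ d → 𝟙 (d ≤? h) * f d)
    ≡⟨ ∑-range-cong (suc h) (λ d d≤h → trans (cong (_* f d) (𝟙-yes (d ≤? h) (ℕ.≤-pred d≤h))) (ℕ.*-identityˡ (f d))) ⟩
  ∑ (range (suc h)) f ∎
  where open ≡-Reasoning

-- Polynomials over a finite field

module Polynomials (F : FiniteField) where

  open FiniteField F renaming (Carrier to C) using (isCommutativeRing; 1≢0; inverse)
  open Poly F public

  fieldRing : CommutativeRing _ _
  fieldRing = record { isCommutativeRing = isCommutativeRing }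

  open CommutativeRing fieldRing public
    using (0#; 1#; +-assoc; +-comm; +-identityˡ; +-identityʳ; -‿inverseʳ;
           *-assoc; *-comm; *-identityˡ; *-identityʳ; distribˡ; distribʳ; zeroˡ; zeroʳ)
    renaming (_+_ to _+ᶠ_; _*_ to _·_; -_ to -ᶠ_)
  open RingProperties (CommutativeRing.ring fieldRing) public
    using (+-cancelˡ; +-cancelʳ; +-inverseʳ-unique; -0#≈0#)
  open CommutativeSemigroupProperties (CommutativeRing.+-commutativeSemigroup fieldRing) public
    using () renaming (interchange to +-interchange; x∙yz≈y∙xz to +-swapˡ)
  open ≡-Reasoning

  x-y≡0⇒x≡y : ∀ x y → x +ᶠ -ᶠ y ≡ 0# → x ≡ y
  x-y≡0⇒x≡y x y e = +-cancelʳ (-ᶠ y) x y (trans e (sym (-‿inverseʳ y)))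

  no-zero-divisors : ∀ a b → a ≢ 0# → a · b ≡ 0# → b ≡ 0#
  no-zero-divisors a b a≢0 ab≡0 = begin
    b                  ≡⟨ sym (*-identityˡ b) ⟩
    1# · b             ≡⟨ cong (_· b) (sym (trans (*-comm _ a) (proj₂ (inverse a a≢0)))) ⟩
    (a⁻¹ · a) · b      ≡⟨ *-assoc a⁻¹ a b ⟩
    a⁻¹ · (a · b)      ≡⟨ cong (a⁻¹ ·_) ab≡0 ⟩
    a⁻¹ · 0#           ≡⟨ zeroʳ a⁻¹ ⟩
    0#                 ∎
    where a⁻¹ = proj₁ (inverse a a≢0)

  Pol : Set
  Pol = List C

  coeff : Pol → ℕ → C
  coeff [] i = 0#
  coeff (x ∷ xs) zero = x
  coeff (x ∷ xs) (suc i) = coeff xs i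

  -- Lists with trailing zeros represent the same polynomial, hence this equivalence.
  infix 4 _≈_
  record _≈_ (p q : Pol) : Set where
    constructor mk≈
    field at : ∀ i → coeff p i ≡ coeff q i
  open _≈_ public

  ≈-refl : ∀ {p} → p ≈ p
  ≈-refl = mk≈ λ i → refl

  ≈-reflexive : ∀ {p q} → p ≡ q → p ≈ q
  ≈-reflexive refl = ≈-refl

  ≈-sym : ∀ {p q} → p ≈ q → q ≈ p
  ≈-sym e = mk≈ λ i → sym (at e i)

  ≈-trans : ∀ {p q r} → p ≈ q → q ≈ r → p ≈ r
  ≈-trans e f = mk≈ λ i → trans (at e i) (at f i)

  ∷-cong : ∀ {x y xs ys} → x ≡ y → xs ≈ ys → (x ∷ xs) ≈ (y ∷ ys)
  ∷-cong e f = mk≈ λ { zero → e ; (suc i) → at f i }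

  ≈-tail : ∀ {x y xs ys} → (x ∷ xs) ≈ (y ∷ ys) → xs ≈ ys
  ≈-tail e = mk≈ λ i → at e (suc i)

  0∷[]≈[] : (0# ∷ []) ≈ []
  0∷[]≈[] = mk≈ λ { zero → refl ; (suc i) → refl }

  ≈⇒≡ : ∀ {p q} → p ≈ q → length p ≡ length q → p ≡ q
  ≈⇒≡ {[]} {[]} e l = refl
  ≈⇒≡ {x ∷ p} {y ∷ q} e l = cong₂ _∷_ (at e 0) (≈⇒≡ (≈-tail e) (ℕ.suc-injective l))

  scale : C → Pol → Pol
  scale c = map (c ·_)

  neg : Pol → Pol
  neg = map -ᶠ_

  coeff-⊕ : ∀ p q i → coeff (p ⊕ q) i ≡ coeff p i +ᶠ coeff q i
  coeff-⊕ [] q i = sym (+-identityˡ _)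
  coeff-⊕ (x ∷ xs) [] i = sym (+-identityʳ _)
  coeff-⊕ (x ∷ xs) (y ∷ ys) zero = refl
  coeff-⊕ (x ∷ xs) (y ∷ ys) (suc i) = coeff-⊕ xs ys i

  coeff-scale : ∀ c p i → coeff (scale c p) i ≡ c · coeff p i
  coeff-scale c [] i = sym (zeroʳ c)
  coeff-scale c (x ∷ p) zero = refl
  coeff-scale c (x ∷ p) (suc i) = coeff-scale c p i

  coeff-neg : ∀ p i → coeff (neg p) i ≡ -ᶠ coeff p i
  coeff-neg [] i = sym -0#≈0#
  coeff-neg (x ∷ p) zero = refl
  coeff-neg (x ∷ p) (suc i) = coeff-neg p i

  coeff-⊛-zero : ∀ x xs q → coeff ((x ∷ xs) ⊛ q) 0 ≡ x · coeff q 0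
  coeff-⊛-zero x xs q = trans (coeff-⊕ (scale x q) (0# ∷ (xs ⊛ q)) 0) (trans (+-identityʳ _) (coeff-scale x q 0))

  coeff-⊛-suc : ∀ x xs q i → coeff ((x ∷ xs) ⊛ q) (suc i) ≡ x · coeff q (suc i) +ᶠ coeff (xs ⊛ q) i
  coeff-⊛-suc x xs q i =
    trans (coeff-⊕ (scale x q) (0# ∷ (xs ⊛ q)) (suc i)) (cong (_+ᶠ coeff (xs ⊛ q) i) (coeff-scale x q (suc i)))

  ⊕-cong : ∀ {p p' q q'} → p ≈ p' → q ≈ q' → (p ⊕ q) ≈ (p' ⊕ q')
  ⊕-cong {p} {p'} {q} {q'} e f = mk≈ λ i →
    trans (coeff-⊕ p q i) (trans (cong₂ _+ᶠ_ (at e i) (at f i)) (sym (coeff-⊕ p' q' i)))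

  ⊕-comm : ∀ p q → (p ⊕ q) ≈ (q ⊕ p)
  ⊕-comm p q = mk≈ λ i → trans (coeff-⊕ p q i) (trans (+-comm _ _) (sym (coeff-⊕ q p i)))

  ⊕-identityˡ : ∀ p {z} → z ≈ [] → (z ⊕ p) ≈ p
  ⊕-identityˡ p {z} e = mk≈ λ i → trans (coeff-⊕ z p i) (trans (cong (_+ᶠ coeff p i) (at e i)) (+-identityˡ _))

  ⊕-identityʳ : ∀ p {z} → z ≈ [] → (p ⊕ z) ≈ p
  ⊕-identityʳ p {z} e = ≈-trans (⊕-comm p z) (⊕-identityˡ p e)

  ⊕-inverseʳ : ∀ p → (p ⊕ neg p) ≈ []
  ⊕-inverseʳ p = mk≈ λ i → trans (coeff-⊕ p (neg p) i) (trans (cong (coeff p i +ᶠ_) (coeff-neg p i)) (-‿inverseʳ _))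

  ⊕-neg-cancelˡ : ∀ a b → ((a ⊕ b) ⊕ neg a) ≈ b
  ⊕-neg-cancelˡ a b = mk≈ λ i → begin
    coeff ((a ⊕ b) ⊕ neg a) i                      ≡⟨ coeff-⊕ (a ⊕ b) (neg a) i ⟩
    coeff (a ⊕ b) i +ᶠ coeff (neg a) i              ≡⟨ cong₂ _+ᶠ_ (coeff-⊕ a b i) (coeff-neg a i) ⟩
    (coeff a i +ᶠ coeff b i) +ᶠ -ᶠ coeff a i        ≡⟨ cong (_+ᶠ -ᶠ coeff a i) (+-comm _ _) ⟩
    (coeff b i +ᶠ coeff a i) +ᶠ -ᶠ coeff a i        ≡⟨ +-assoc _ _ _ ⟩
    coeff b i +ᶠ (coeff a i +ᶠ -ᶠ coeff a i)        ≡⟨ cong (coeff b i +ᶠ_) (-‿inverseʳ _) ⟩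
    coeff b i +ᶠ 0#                                ≡⟨ +-identityʳ _ ⟩
    coeff b i                                      ∎

  ≈-⊕⇒⊕neg : ∀ {a b c} → a ≈ (b ⊕ c) → (a ⊕ neg b) ≈ c
  ≈-⊕⇒⊕neg {a} {b} {c} e = ≈-trans (⊕-cong e ≈-refl) (⊕-neg-cancelˡ b c)

  scale-cong : ∀ c {p q} → p ≈ q → scale c p ≈ scale c q
  scale-cong c {p} {q} e = mk≈ λ i → trans (coeff-scale c p i) (trans (cong (c ·_) (at e i)) (sym (coeff-scale c q i)))

  neg-cong : ∀ {p q} → p ≈ q → neg p ≈ neg q
  neg-cong {p} {q} e = mk≈ λ i → trans (coeff-neg p i) (trans (cong -ᶠ_ (at e i)) (sym (coeff-neg q i)))

  scale-identity : ∀ p → scale 1# p ≈ p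
  scale-identity p = mk≈ λ i → trans (coeff-scale 1# p i) (*-identityˡ _)

  scale-zero : ∀ p → scale 0# p ≈ []
  scale-zero p = mk≈ λ i → trans (coeff-scale 0# p i) (zeroˡ _)

  ⊛-congʳ : ∀ p {q q'} → q ≈ q' → (p ⊛ q) ≈ (p ⊛ q')
  ⊛-congʳ [] e = ≈-refl
  ⊛-congʳ (x ∷ p) e = ⊕-cong (scale-cong x e) (∷-cong refl (⊛-congʳ p e))

  ⊛-zeroʳ : ∀ p → (p ⊛ []) ≈ []
  ⊛-zeroʳ [] = ≈-refl
  ⊛-zeroʳ (x ∷ p) = ≈-trans (∷-cong refl (⊛-zeroʳ p)) 0∷[]≈[]

  ⊛-∷ʳ : ∀ p y ys → (p ⊛ (y ∷ ys)) ≈ (scale y p ⊕ (0# ∷ (p ⊛ ys)))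
  ⊛-∷ʳ p y ys = mk≈ (pointwise p)
    where
    pointwise : ∀ p i → coeff (p ⊛ (y ∷ ys)) i ≡ coeff (scale y p ⊕ (0# ∷ (p ⊛ ys))) i
    pointwise [] zero = refl
    pointwise [] (suc i) = refl
    pointwise (x ∷ xs) zero = begin
      coeff ((x ∷ xs) ⊛ (y ∷ ys)) 0  ≡⟨ coeff-⊛-zero x xs (y ∷ ys) ⟩
      x · y                          ≡⟨ *-comm x y ⟩
      y · x                          ≡⟨ sym (+-identityʳ _) ⟩
      y · x +ᶠ 0#                    ∎
    pointwise (x ∷ xs) (suc i) = begin
      coeff ((x ∷ xs) ⊛ (y ∷ ys)) (suc i)
        ≡⟨ coeff-⊛-suc x xs (y ∷ ys) i ⟩
      x · coeff ys i +ᶠ coeff (xs ⊛ (y ∷ ys)) i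
        ≡⟨ cong (x · coeff ys i +ᶠ_) (trans (pointwise xs i) (coeff-⊕ (scale y xs) _ i)) ⟩
      x · coeff ys i +ᶠ (coeff (scale y xs) i +ᶠ coeff (0# ∷ (xs ⊛ ys)) i)
        ≡⟨ +-swapˡ _ _ _ ⟩
      coeff (scale y xs) i +ᶠ (x · coeff ys i +ᶠ coeff (0# ∷ (xs ⊛ ys)) i)
        ≡⟨ cong (coeff (scale y xs) i +ᶠ_) (sym (coeff-∷⊛ i)) ⟩
      coeff (scale y xs) i +ᶠ coeff ((x ∷ xs) ⊛ ys) i
        ≡⟨ sym (coeff-⊕ (scale y xs) _ i) ⟩
      coeff (scale y xs ⊕ ((x ∷ xs) ⊛ ys)) i ∎
      where
      coeff-∷⊛ : ∀ i → coeff ((x ∷ xs) ⊛ ys) i ≡ x · coeff ys i +ᶠ coeff (0# ∷ (xs ⊛ ys)) i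
      coeff-∷⊛ i = trans (coeff-⊕ (scale x ys) _ i) (cong (_+ᶠ coeff (0# ∷ (xs ⊛ ys)) i) (coeff-scale x ys i))

  ⊛-comm : ∀ p q → (p ⊛ q) ≈ (q ⊛ p)
  ⊛-comm [] q = ≈-sym (⊛-zeroʳ q)
  ⊛-comm (x ∷ xs) q = ≈-trans (⊕-cong ≈-refl (∷-cong refl (⊛-comm xs q))) (≈-sym (⊛-∷ʳ q x xs))

  ⊛-congˡ : ∀ {p p'} q → p ≈ p' → (p ⊛ q) ≈ (p' ⊛ q)
  ⊛-congˡ {p} {p'} q e = ≈-trans (⊛-comm p q) (≈-trans (⊛-congʳ q e) (⊛-comm q p'))

  ⊛-distribʳ : ∀ p q r → ((p ⊕ q) ⊛ r) ≈ ((p ⊛ r) ⊕ (q ⊛ r))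
  ⊛-distribʳ p q r = mk≈ (pointwise p q)
    where
    pointwise : ∀ p q i → coeff ((p ⊕ q) ⊛ r) i ≡ coeff ((p ⊛ r) ⊕ (q ⊛ r)) i
    pointwise [] q i = refl
    pointwise (x ∷ p) [] i = sym (trans (coeff-⊕ ((x ∷ p) ⊛ r) [] i) (+-identityʳ _))
    pointwise (x ∷ p) (y ∷ q) zero = begin
      coeff (((x ∷ p) ⊕ (y ∷ q)) ⊛ r) 0                 ≡⟨ coeff-⊛-zero (x +ᶠ y) (p ⊕ q) r ⟩
      (x +ᶠ y) · coeff r 0                              ≡⟨ distribʳ _ x y ⟩
      x · coeff r 0 +ᶠ y · coeff r 0                    ≡⟨ sym (cong₂ _+ᶠ_ (coeff-⊛-zero x p r) (coeff-⊛-zero y q r)) ⟩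
      coeff ((x ∷ p) ⊛ r) 0 +ᶠ coeff ((y ∷ q) ⊛ r) 0    ≡⟨ sym (coeff-⊕ ((x ∷ p) ⊛ r) _ 0) ⟩
      coeff (((x ∷ p) ⊛ r) ⊕ ((y ∷ q) ⊛ r)) 0           ∎
    pointwise (x ∷ p) (y ∷ q) (suc i) = begin
      coeff (((x ∷ p) ⊕ (y ∷ q)) ⊛ r) (suc i)
        ≡⟨ coeff-⊛-suc (x +ᶠ y) (p ⊕ q) r i ⟩
      (x +ᶠ y) · coeff r (suc i) +ᶠ coeff ((p ⊕ q) ⊛ r) i
        ≡⟨ cong₂ _+ᶠ_ (distribʳ _ x y) (trans (pointwise p q i) (coeff-⊕ (p ⊛ r) _ i)) ⟩
      (x · coeff r (suc i) +ᶠ y · coeff r (suc i)) +ᶠ (coeff (p ⊛ r) i +ᶠ coeff (q ⊛ r) i)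
        ≡⟨ +-interchange _ _ _ _ ⟩
      (x · coeff r (suc i) +ᶠ coeff (p ⊛ r) i) +ᶠ (y · coeff r (suc i) +ᶠ coeff (q ⊛ r) i)
        ≡⟨ sym (cong₂ _+ᶠ_ (coeff-⊛-suc x p r i) (coeff-⊛-suc y q r i)) ⟩
      coeff ((x ∷ p) ⊛ r) (suc i) +ᶠ coeff ((y ∷ q) ⊛ r) (suc i)
        ≡⟨ sym (coeff-⊕ ((x ∷ p) ⊛ r) _ (suc i)) ⟩
      coeff (((x ∷ p) ⊛ r) ⊕ ((y ∷ q) ⊛ r)) (suc i) ∎

  ⊛-distribˡ : ∀ p q r → (p ⊛ (q ⊕ r)) ≈ ((p ⊛ q) ⊕ (p ⊛ r))
  ⊛-distribˡ p q r = ≈-trans (⊛-comm p _) (≈-trans (⊛-distribʳ q r p) (⊕-cong (⊛-comm q p) (⊛-comm r p)))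

  ⊛-scaleˡ : ∀ c p q → (scale c p ⊛ q) ≈ scale c (p ⊛ q)
  ⊛-scaleˡ c p q = mk≈ (pointwise p)
    where
    pointwise : ∀ p i → coeff (scale c p ⊛ q) i ≡ coeff (scale c (p ⊛ q)) i
    pointwise [] i = refl
    pointwise (x ∷ p) zero = begin
      coeff (scale c (x ∷ p) ⊛ q) 0   ≡⟨ coeff-⊛-zero (c · x) (scale c p) q ⟩
      (c · x) · coeff q 0             ≡⟨ *-assoc c x _ ⟩
      c · (x · coeff q 0)             ≡⟨ cong (c ·_) (sym (coeff-⊛-zero x p q)) ⟩
      c · coeff ((x ∷ p) ⊛ q) 0       ≡⟨ sym (coeff-scale c ((x ∷ p) ⊛ q) 0) ⟩
      coeff (scale c ((x ∷ p) ⊛ q)) 0 ∎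
    pointwise (x ∷ p) (suc i) = begin
      coeff (scale c (x ∷ p) ⊛ q) (suc i)
        ≡⟨ coeff-⊛-suc (c · x) (scale c p) q i ⟩
      (c · x) · coeff q (suc i) +ᶠ coeff (scale c p ⊛ q) i
        ≡⟨ cong₂ _+ᶠ_ (*-assoc c x _) (trans (pointwise p i) (coeff-scale c (p ⊛ q) i)) ⟩
      c · (x · coeff q (suc i)) +ᶠ c · coeff (p ⊛ q) i
        ≡⟨ sym (distribˡ c _ _) ⟩
      c · (x · coeff q (suc i) +ᶠ coeff (p ⊛ q) i)
        ≡⟨ cong (c ·_) (sym (coeff-⊛-suc x p q i)) ⟩
      c · coeff ((x ∷ p) ⊛ q) (suc i)
        ≡⟨ sym (coeff-scale c ((x ∷ p) ⊛ q) (suc i)) ⟩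
      coeff (scale c ((x ∷ p) ⊛ q)) (suc i) ∎

  ⊛-scaleʳ : ∀ c p q → (p ⊛ scale c q) ≈ scale c (p ⊛ q)
  ⊛-scaleʳ c p q = ≈-trans (⊛-comm p _) (≈-trans (⊛-scaleˡ c q p) (scale-cong c (⊛-comm q p)))

  ⊛-assoc : ∀ p q r → ((p ⊛ q) ⊛ r) ≈ (p ⊛ (q ⊛ r))
  ⊛-assoc [] q r = ≈-refl
  ⊛-assoc (x ∷ p) q r =
    ≈-trans (⊛-distribʳ (scale x q) (0# ∷ (p ⊛ q)) r)
      (⊕-cong (⊛-scaleˡ x q r) (≈-trans 0∷⊛ (∷-cong refl (⊛-assoc p q r))))
    where
    0∷⊛ : ((0# ∷ (p ⊛ q)) ⊛ r) ≈ (0# ∷ ((p ⊛ q) ⊛ r))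
    0∷⊛ = ⊕-identityˡ _ (scale-zero r)

  ⊛-identityˡ : ∀ p → ((1# ∷ []) ⊛ p) ≈ p
  ⊛-identityˡ p = ≈-trans (⊕-cong (scale-identity p) 0∷[]≈[]) (⊕-identityʳ p ≈-refl)

  ⊛-identityʳ : ∀ p → (p ⊛ (1# ∷ [])) ≈ p
  ⊛-identityʳ p = ≈-trans (⊛-comm p _) (⊛-identityˡ p)

  ⊛-≈[]ʳ : ∀ p {z} → z ≈ [] → (p ⊛ z) ≈ []
  ⊛-≈[]ʳ p e = ≈-trans (⊛-congʳ p e) (⊛-zeroʳ p)

  ⊛-negʳ : ∀ p q → (p ⊛ neg q) ≈ neg (p ⊛ q)
  ⊛-negʳ p q = mk≈ λ i →
    trans (+-inverseʳ-unique (coeff (p ⊛ q) i) (coeff (p ⊛ neg q) i) (sum≡0 i)) (sym (coeff-neg (p ⊛ q) i))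
    where
    sum≡0 : ∀ i → coeff (p ⊛ q) i +ᶠ coeff (p ⊛ neg q) i ≡ 0#
    sum≡0 i = trans (sym (coeff-⊕ (p ⊛ q) _ i))
                (trans (sym (at (⊛-distribˡ p q (neg q)) i)) (at (⊛-≈[]ʳ p (⊕-inverseʳ q)) i))

  record DegreeBelow (p : Pol) (k : ℕ) : Set where
    constructor degree<
    field vanishes : ∀ i → k ≤ i → coeff p i ≡ 0#
  open DegreeBelow public

  Degree : Pol → ℕ → Set
  Degree p m = DegreeBelow p (suc m) × (coeff p m ≢ 0#)

  DegreeBelow-≈ : ∀ {p q k} → p ≈ q → DegreeBelow p k → DegreeBelow q k
  DegreeBelow-≈ e d = degree< λ i k≤i → trans (sym (at e i)) (vanishes d i k≤i)

  Degree-≈ : ∀ {p q m} → p ≈ q → Degree p m → Degree q m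
  Degree-≈ e (d , top≢0) = DegreeBelow-≈ e d , λ top≡0 → top≢0 (trans (at e _) top≡0)

  DegreeBelow-mono : ∀ {p j k} → j ≤ k → DegreeBelow p j → DegreeBelow p k
  DegreeBelow-mono j≤k d = degree< λ i k≤i → vanishes d i (ℕ.≤-trans j≤k k≤i)

  DegreeBelow-length : ∀ p → DegreeBelow p (length p)
  DegreeBelow-length p = degree< (beyond p)
    where
    beyond : ∀ p i → length p ≤ i → coeff p i ≡ 0#
    beyond [] i _ = refl
    beyond (x ∷ p) (suc i) (s≤s le) = beyond p i le

  DegreeBelow-zero : ∀ {p} → DegreeBelow p 0 → p ≈ []
  DegreeBelow-zero d = mk≈ λ i → vanishes d i z≤n

  DegreeBelow-tail : ∀ {x xs k} → DegreeBelow (x ∷ xs) (suc k) → DegreeBelow xs k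
  DegreeBelow-tail d = degree< λ i le → vanishes d (suc i) (s≤s le)

  ≈[]⇒DegreeBelow : ∀ {p} k → p ≈ [] → DegreeBelow p k
  ≈[]⇒DegreeBelow k e = degree< λ i _ → at e i

  ≈[]⊎Degree : ∀ p → p ≈ [] ⊎ Σ ℕ (Degree p)
  ≈[]⊎Degree p = search (length p) (DegreeBelow-length p)
    where
    search : ∀ k → DegreeBelow p k → p ≈ [] ⊎ Σ ℕ (Degree p)
    search zero d = inj₁ (DegreeBelow-zero d)
    search (suc k) d with coeff p k ≟C 0#
    ... | no top≢0 = inj₂ (k , d , top≢0)
    ... | yes top≡0 = search k (degree< below)
      where
      below : ∀ i → k ≤ i → coeff p i ≡ 0#
      below i k≤i with ℕ.m≤n⇒m<n∨m≡n k≤i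
      ... | inj₁ k<i = vanishes d i k<i
      ... | inj₂ refl = top≡0

  Degree⇒≉[] : ∀ {p m} → Degree p m → ¬ (p ≈ [])
  Degree⇒≉[] (d , top≢0) e = top≢0 (at e _)

  Degree-DegreeBelow⇒< : ∀ {p m k} → Degree p m → DegreeBelow p k → m < k
  Degree-DegreeBelow⇒< {m = m} {k} (d , top≢0) d' with m ℕ.<? k
  ... | yes m<k = m<k
  ... | no m≮k = ⊥-elim (top≢0 (vanishes d' m (ℕ.≮⇒≥ m≮k)))

  Degree-unique : ∀ {p m m'} → Degree p m → Degree p m' → m ≡ m'
  Degree-unique D D' =
    ℕ.≤-antisym (ℕ.≤-pred (Degree-DegreeBelow⇒< D (proj₁ D'))) (ℕ.≤-pred (Degree-DegreeBelow⇒< D' (proj₁ D)))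

  monicᴸ : List C → Pol
  monicᴸ as = as ++ [ 1# ]

  coeff-monicᴸ-top : ∀ as → coeff (monicᴸ as) (length as) ≡ 1#
  coeff-monicᴸ-top [] = refl
  coeff-monicᴸ-top (x ∷ as) = coeff-monicᴸ-top as

  length-monicᴸ : ∀ as → length (monicᴸ as) ≡ suc (length as)
  length-monicᴸ as = trans (List.length-++ as) (ℕ.+-comm (length as) 1)

  Degree-monicᴸ : ∀ as → Degree (monicᴸ as) (length as)
  Degree-monicᴸ as =
    subst (DegreeBelow (monicᴸ as)) (length-monicᴸ as) (DegreeBelow-length (monicᴸ as)) ,
    λ top≡0 → 1≢0 (trans (sym (coeff-monicᴸ-top as)) top≡0)

  monicᴸ≉[] : ∀ as → ¬ (monicᴸ as ≈ [])
  monicᴸ≉[] as = Degree⇒≉[] (Degree-monicᴸ as)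

  monicᴸ-injective : ∀ {as bs} → monicᴸ as ≈ monicᴸ bs → as ≡ bs
  monicᴸ-injective {as} {bs} e = proj₁ (List.∷ʳ-injective as bs (≈⇒≡ e same-length))
    where
    same-length : length (monicᴸ as) ≡ length (monicᴸ bs)
    same-length = trans (length-monicᴸ as) (trans (cong suc (Degree-unique (Degree-≈ e (Degree-monicᴸ as)) (Degree-monicᴸ bs)))
                                                  (sym (length-monicᴸ bs)))

  ≈monicᴸ : ∀ m p → DegreeBelow p (suc m) → coeff p m ≡ 1# → Σ (List C) λ as → (length as ≡ m) × (p ≈ monicᴸ as)
  ≈monicᴸ zero p d top≡1 = [] , refl , mk≈ λ { zero → top≡1 ; (suc i) → vanishes d (suc i) (s≤s z≤n) }
  ≈monicᴸ (suc m) [] d top≡1 = ⊥-elim (1≢0 (sym top≡1))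
  ≈monicᴸ (suc m) (x ∷ xs) d top≡1 with ≈monicᴸ m xs (DegreeBelow-tail d) top≡1
  ... | as , refl , e = x ∷ as , refl , ∷-cong refl e

  ⊛-leading : ∀ p q a b → DegreeBelow p (suc a) → DegreeBelow q (suc b) →
    DegreeBelow (p ⊛ q) (suc (a + b)) × (coeff (p ⊛ q) (a + b) ≡ coeff p a · coeff q b)
  ⊛-leading [] q a b dp dq = degree< (λ i _ → refl) , sym (zeroˡ _)
  ⊛-leading (x ∷ xs) q zero b dp dq = degree< below , top
    where
    x∷xs⊛q≈xq : ((x ∷ xs) ⊛ q) ≈ scale x q
    x∷xs⊛q≈xq = ⊕-identityʳ (scale x q) (≈-trans (∷-cong refl (≈-trans (⊛-comm xs q) (⊛-≈[]ʳ q (DegreeBelow-zero (DegreeBelow-tail dp))))) 0∷[]≈[])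
    below : ∀ i → suc b ≤ i → coeff ((x ∷ xs) ⊛ q) i ≡ 0#
    below i le = trans (at x∷xs⊛q≈xq i) (trans (coeff-scale x q i) (trans (cong (x ·_) (vanishes dq i le)) (zeroʳ x)))
    top : coeff ((x ∷ xs) ⊛ q) b ≡ x · coeff q b
    top = trans (at x∷xs⊛q≈xq b) (coeff-scale x q b)
  ⊛-leading (x ∷ xs) q (suc a) b dp dq = degree< below , top
    where
    ih : DegreeBelow (xs ⊛ q) (suc (a + b)) × (coeff (xs ⊛ q) (a + b) ≡ coeff xs a · coeff q b)
    ih = ⊛-leading xs q a b (DegreeBelow-tail dp) dq
    below : ∀ i → suc (suc a + b) ≤ i → coeff ((x ∷ xs) ⊛ q) i ≡ 0#
    below (suc i) (s≤s le) = begin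
      coeff ((x ∷ xs) ⊛ q) (suc i)              ≡⟨ coeff-⊛-suc x xs q i ⟩
      x · coeff q (suc i) +ᶠ coeff (xs ⊛ q) i   ≡⟨ cong₂ _+ᶠ_ (cong (x ·_) (vanishes dq (suc i) (s≤s b≤i))) (vanishes (proj₁ ih) i le) ⟩
      x · 0# +ᶠ 0#                              ≡⟨ trans (+-identityʳ _) (zeroʳ x) ⟩
      0#                                        ∎
      where b≤i = ℕ.≤-trans (ℕ.m≤n+m b a) (ℕ.≤-trans (ℕ.n≤1+n _) le)
    top : coeff ((x ∷ xs) ⊛ q) (suc a + b) ≡ coeff xs a · coeff q b
    top = begin
      coeff ((x ∷ xs) ⊛ q) (suc (a + b))                    ≡⟨ coeff-⊛-suc x xs q (a + b) ⟩
      x · coeff q (suc (a + b)) +ᶠ coeff (xs ⊛ q) (a + b)   ≡⟨ cong₂ _+ᶠ_ (cong (x ·_) (vanishes dq (suc (a + b)) (s≤s (ℕ.m≤n+m b a)))) (proj₂ ih) ⟩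
      x · 0# +ᶠ coeff xs a · coeff q b                      ≡⟨ trans (cong (_+ᶠ (coeff xs a · coeff q b)) (zeroʳ x)) (+-identityˡ _) ⟩
      coeff xs a · coeff q b                                ∎

  Degree-monicᴸ⊛ : ∀ gs s m → Degree s m →
    Degree (monicᴸ gs ⊛ s) (length gs + m) × (coeff (monicᴸ gs ⊛ s) (length gs + m) ≡ coeff s m)
  Degree-monicᴸ⊛ gs s m (d , top≢0) = (proj₁ leading , λ top≡0 → top≢0 (trans (sym top) top≡0)) , top
    where
    leading : DegreeBelow (monicᴸ gs ⊛ s) (suc (length gs + m))
            × (coeff (monicᴸ gs ⊛ s) (length gs + m) ≡ coeff (monicᴸ gs) (length gs) · coeff s m)
    leading = ⊛-leading (monicᴸ gs) s (length gs) m (proj₁ (Degree-monicᴸ gs)) d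
    top : coeff (monicᴸ gs ⊛ s) (length gs + m) ≡ coeff s m
    top = trans (proj₂ leading) (trans (cong (_· coeff s m) (coeff-monicᴸ-top gs)) (*-identityˡ _))

  DegreeBelow-cofactor : ∀ gs s j → DegreeBelow (monicᴸ gs ⊛ s) (length gs + j) → DegreeBelow s j
  DegreeBelow-cofactor gs s j d with ≈[]⊎Degree s
  ... | inj₁ s≈[] = ≈[]⇒DegreeBelow j s≈[]
  ... | inj₂ (m , D) = DegreeBelow-mono m<j (proj₁ D)
    where
    m<j : suc m ≤ j
    m<j = ℕ.+-cancelˡ-≤ (length gs) (suc m) j
            (subst (_≤ length gs + j) (sym (ℕ.+-suc (length gs) m)) (Degree-DegreeBelow⇒< (proj₁ (Degree-monicᴸ⊛ gs s m D)) d))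

  monicᴸ⊛monicᴸ : ∀ as bs → Σ (List C) λ cs → (length cs ≡ length as + length bs) × ((monicᴸ as ⊛ monicᴸ bs) ≈ monicᴸ cs)
  monicᴸ⊛monicᴸ as bs = ≈monicᴸ (length as + length bs) (monicᴸ as ⊛ monicᴸ bs) (proj₁ (proj₁ D)) top≡1
    where
    D : Degree (monicᴸ as ⊛ monicᴸ bs) (length as + length bs)
      × (coeff (monicᴸ as ⊛ monicᴸ bs) (length as + length bs) ≡ coeff (monicᴸ bs) (length bs))
    D = Degree-monicᴸ⊛ as (monicᴸ bs) (length bs) (Degree-monicᴸ bs)
    top≡1 : coeff (monicᴸ as ⊛ monicᴸ bs) (length as + length bs) ≡ 1#
    top≡1 = trans (proj₂ D) (coeff-monicᴸ-top bs)

  monicᴸ-cofactor : ∀ gs t fs → (monicᴸ gs ⊛ t) ≈ monicᴸ fs →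
    Σ (List C) λ bs → (length gs + length bs ≡ length fs) × (t ≈ monicᴸ bs)
  monicᴸ-cofactor gs t fs e with ≈[]⊎Degree t
  ... | inj₁ t≈[] = ⊥-elim (monicᴸ≉[] fs (≈-trans (≈-sym e) (⊛-≈[]ʳ (monicᴸ gs) t≈[])))
  ... | inj₂ (j , D) with ≈monicᴸ j t (proj₁ D) top≡1
    where
    D⊛ : Degree (monicᴸ gs ⊛ t) (length gs + j) × (coeff (monicᴸ gs ⊛ t) (length gs + j) ≡ coeff t j)
    D⊛ = Degree-monicᴸ⊛ gs t j D
    deg≡ : length gs + j ≡ length fs
    deg≡ = Degree-unique (Degree-≈ e (proj₁ D⊛)) (Degree-monicᴸ fs)
    top≡1 : coeff t j ≡ 1#
    top≡1 = trans (sym (proj₂ D⊛)) (trans (at e _) (trans (cong (coeff (monicᴸ fs)) deg≡) (coeff-monicᴸ-top fs)))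
  ... | bs , refl , t≈bs = bs , Degree-unique (Degree-≈ e (proj₁ (Degree-monicᴸ⊛ gs t (length bs) D))) (Degree-monicᴸ fs) , t≈bs

  divMod : ∀ gs p → Σ Pol λ t → Σ Pol λ r → DegreeBelow r (length gs) × (p ≈ ((monicᴸ gs ⊛ t) ⊕ r))
  divMod gs [] = [] , [] , degree< (λ i _ → refl) , ≈-sym (≈-trans (⊕-identityʳ _ ≈-refl) (⊛-zeroʳ (monicᴸ gs)))
  divMod gs (x ∷ xs) with divMod gs xs
  ... | t' , r' , d' , e' = c ∷ t' , r , degree< r-vanishes , mk≈ quotient-remainder
    where
    k : ℕ
    k = length gs
    G w : Pol
    G = monicᴸ gs
    w = x ∷ r'
    c : C
    c = coeff w k
    r : Pol
    r = w ⊕ neg (scale c G)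
    coeff-r : ∀ i → coeff r i ≡ coeff w i +ᶠ -ᶠ (c · coeff G i)
    coeff-r i = trans (coeff-⊕ w (neg (scale c G)) i) (cong (coeff w i +ᶠ_) (trans (coeff-neg (scale c G) i) (cong -ᶠ_ (coeff-scale c G i))))
    w-vanishes : ∀ i → suc k ≤ i → coeff w i ≡ 0#
    w-vanishes (suc i) (s≤s le) = vanishes d' i le
    r-vanishes : ∀ i → k ≤ i → coeff r i ≡ 0#
    r-vanishes i k≤i with ℕ.m≤n⇒m<n∨m≡n k≤i
    ... | inj₂ refl = trans (coeff-r k) (trans (cong (λ z → c +ᶠ -ᶠ (c · z)) (coeff-monicᴸ-top gs))
                        (trans (cong (λ z → c +ᶠ -ᶠ z) (*-identityʳ c)) (-‿inverseʳ c)))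
    ... | inj₁ k<i = trans (coeff-r i) (trans (cong₂ (λ u v → u +ᶠ -ᶠ (c · v)) (w-vanishes i k<i) (vanishes (proj₁ (Degree-monicᴸ gs)) i k<i))
                        (trans (cong (λ z → 0# +ᶠ -ᶠ z) (zeroʳ c)) (trans (+-identityˡ _) -0#≈0#)))
    quotient-remainder : ∀ i → coeff (x ∷ xs) i ≡ coeff ((G ⊛ (c ∷ t')) ⊕ r) i
    quotient-remainder i = sym (begin
      coeff ((G ⊛ (c ∷ t')) ⊕ r) i
        ≡⟨ coeff-⊕ (G ⊛ (c ∷ t')) r i ⟩
      coeff (G ⊛ (c ∷ t')) i +ᶠ coeff r i
        ≡⟨ cong₂ _+ᶠ_ (trans (at (⊛-∷ʳ G c t') i) (trans (coeff-⊕ (scale c G) _ i)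
                        (cong (_+ᶠ coeff (0# ∷ (G ⊛ t')) i) (coeff-scale c G i))))
                      (coeff-r i) ⟩
      (c · coeff G i +ᶠ coeff (0# ∷ (G ⊛ t')) i) +ᶠ (coeff w i +ᶠ -ᶠ (c · coeff G i))
        ≡⟨ cancel (c · coeff G i) _ _ ⟩
      coeff (0# ∷ (G ⊛ t')) i +ᶠ coeff w i
        ≡⟨ shifted i ⟩
      coeff (x ∷ xs) i ∎)
      where
      cancel : ∀ a b v → (a +ᶠ b) +ᶠ (v +ᶠ -ᶠ a) ≡ b +ᶠ v
      cancel a b v = begin
        (a +ᶠ b) +ᶠ (v +ᶠ -ᶠ a)   ≡⟨ cong (_+ᶠ (v +ᶠ -ᶠ a)) (+-comm a b) ⟩
        (b +ᶠ a) +ᶠ (v +ᶠ -ᶠ a)   ≡⟨ +-interchange b a v (-ᶠ a) ⟩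
        (b +ᶠ v) +ᶠ (a +ᶠ -ᶠ a)   ≡⟨ cong ((b +ᶠ v) +ᶠ_) (-‿inverseʳ a) ⟩
        (b +ᶠ v) +ᶠ 0#            ≡⟨ +-identityʳ _ ⟩
        b +ᶠ v                    ∎
      shifted : ∀ i → coeff (0# ∷ (G ⊛ t')) i +ᶠ coeff w i ≡ coeff (x ∷ xs) i
      shifted zero = +-identityˡ x
      shifted (suc i) = trans (sym (coeff-⊕ (G ⊛ t') r' i)) (sym (at e' i))

  infix 4 _∣_
  record _∣_ (g f : Pol) : Set where
    constructor divides
    field quotient : Pol
          equation : f ≈ (g ⊛ quotient)
  open _∣_ public

  ∣-congʳ : ∀ {g f f'} → f ≈ f' → g ∣ f → g ∣ f'
  ∣-congʳ e (divides t e') = divides t (≈-trans (≈-sym e) e')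

  ∣-congˡ : ∀ {g g' f} → g ≈ g' → g ∣ f → g' ∣ f
  ∣-congˡ e (divides t e') = divides t (≈-trans e' (⊛-congˡ t e))

  ∣-⊛ʳ : ∀ g h → g ∣ (g ⊛ h)
  ∣-⊛ʳ g h = divides h ≈-refl

  ∣-refl : ∀ g → g ∣ g
  ∣-refl g = divides (1# ∷ []) (≈-sym (⊛-identityʳ g))

  1∣ : ∀ f → (1# ∷ []) ∣ f
  1∣ f = divides f (≈-sym (⊛-identityˡ f))

  ∣-trans : ∀ {a b c} → a ∣ b → b ∣ c → a ∣ c
  ∣-trans {a} (divides t e) (divides u e') = divides (t ⊛ u) (≈-trans e' (≈-trans (⊛-congˡ u e) (⊛-assoc a t u)))

  ∣⇒∣⊛ˡ : ∀ {g f} h → g ∣ f → g ∣ (h ⊛ f)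
  ∣⇒∣⊛ˡ {f = f} h g∣f = ∣-congʳ (⊛-comm f h) (∣-trans g∣f (∣-⊛ʳ f h))

  ∣-⊕ : ∀ {g a b} → g ∣ a → g ∣ b → g ∣ (a ⊕ b)
  ∣-⊕ {g} (divides t e) (divides u e') = divides (t ⊕ u) (≈-trans (⊕-cong e e') (≈-sym (⊛-distribˡ g t u)))

  ∣-neg : ∀ {g a} → g ∣ a → g ∣ neg a
  ∣-neg {g} (divides t e) = divides (neg t) (≈-trans (neg-cong e) (≈-sym (⊛-negʳ g t)))

  ∣-scale : ∀ {g a} c → g ∣ a → g ∣ scale c a
  ∣-scale {g} c (divides t e) = divides (scale c t) (≈-trans (scale-cong c e) (≈-sym (⊛-scaleʳ c g t)))

  ∣⇒⊛∣⊛ : ∀ c {a b} → a ∣ b → (c ⊛ a) ∣ (c ⊛ b)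
  ∣⇒⊛∣⊛ c {a} (divides t e) = divides t (≈-trans (⊛-congʳ c e) (≈-sym (⊛-assoc c a t)))

  monicᴸ-cancel : ∀ gs {a b} → (monicᴸ gs ⊛ a) ≈ (monicᴸ gs ⊛ b) → a ≈ b
  monicᴸ-cancel gs {a} {b} e = mk≈ λ i → x-y≡0⇒x≡y _ _
    (trans (sym (trans (coeff-⊕ a (neg b) i) (cong (coeff a i +ᶠ_) (coeff-neg b i)))) (at a-b≈[] i))
    where
    G = monicᴸ gs
    G⊛[a-b]≈[] : (G ⊛ (a ⊕ neg b)) ≈ []
    G⊛[a-b]≈[] = ≈-trans (⊛-distribˡ G a (neg b)) (≈-trans (⊕-cong e (⊛-negʳ G b)) (⊕-inverseʳ (G ⊛ b)))
    a-b≈[] : (a ⊕ neg b) ≈ []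
    a-b≈[] = DegreeBelow-zero (DegreeBelow-cofactor gs (a ⊕ neg b) 0 (≈[]⇒DegreeBelow _ G⊛[a-b]≈[]))

  ∣monicᴸ⇒length≤ : ∀ gs fs → monicᴸ gs ∣ monicᴸ fs → length gs ≤ length fs
  ∣monicᴸ⇒length≤ gs fs (divides t e) with monicᴸ-cofactor gs t fs (≈-sym e)
  ... | bs , deg≡ , _ = subst (length gs ≤_) deg≡ (ℕ.m≤m+n _ _)

  _∣?_ : ∀ gs f → Dec (monicᴸ gs ∣ f)
  gs ∣? f with divMod gs f
  ... | t , r , r<gs , f≈Gt+r with ≈[]⊎Degree r
  ... | inj₁ r≈[] = yes (divides t (≈-trans f≈Gt+r (⊕-identityʳ _ r≈[])))
  ... | inj₂ (m , D) = no λ { (divides u f≈Gu) → Degree⇒≉[] D (DegreeBelow-zero (remainder-vanishes u f≈Gu)) }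
    where
    remainder-vanishes : ∀ u → f ≈ (monicᴸ gs ⊛ u) → DegreeBelow r 0
    remainder-vanishes u f≈Gu = degree< λ i _ → trans (at r≈Gs i) (at (⊛-≈[]ʳ (monicᴸ gs) (DegreeBelow-zero s<0)) i)
      where
      s = u ⊕ neg t
      r≈Gs : r ≈ (monicᴸ gs ⊛ s)
      r≈Gs = ≈-trans (≈-sym (≈-⊕⇒⊕neg (≈-trans (≈-sym f≈Gu) f≈Gt+r)))
               (≈-trans (⊕-cong ≈-refl (≈-sym (⊛-negʳ (monicᴸ gs) t))) (≈-sym (⊛-distribˡ (monicᴸ gs) u (neg t))))
      s<0 : DegreeBelow s 0
      s<0 = DegreeBelow-mono z≤n (DegreeBelow-cofactor gs s 0 (subst (DegreeBelow (monicᴸ gs ⊛ s)) (sym (ℕ.+-identityʳ _)) (DegreeBelow-≈ r≈Gs r<gs)))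

  Irreducibleᴸ : List C → Set
  Irreducibleᴸ ps = (1 ≤ length ps) ×
    (∀ as bs → 1 ≤ length as → 1 ≤ length bs → ¬ ((monicᴸ as ⊛ monicᴸ bs) ≈ monicᴸ ps))

  monicᴸ-associate : ∀ r m → Degree r m →
    Σ (List C) λ as → (length as ≡ m) × (∀ h g → g ∣ (r ⊛ h) → g ∣ (monicᴸ as ⊛ h))
  monicᴸ-associate r m (d , top≢0) with ≈monicᴸ m (scale top⁻¹ r) d' top'≡1
    where
    top⁻¹ : C
    top⁻¹ = proj₁ (inverse (coeff r m) top≢0)
    d' : DegreeBelow (scale top⁻¹ r) (suc m)
    d' = degree< λ i le → trans (coeff-scale top⁻¹ r i) (trans (cong (top⁻¹ ·_) (vanishes d i le)) (zeroʳ top⁻¹))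
    top'≡1 : coeff (scale top⁻¹ r) m ≡ 1#
    top'≡1 = trans (coeff-scale top⁻¹ r m) (trans (*-comm top⁻¹ _) (proj₂ (inverse (coeff r m) top≢0)))
  ... | as , refl , e = as , refl , λ h g g∣rh →
    ∣-congʳ (≈-trans (≈-sym (⊛-scaleˡ top⁻¹ r h)) (⊛-congˡ h e)) (∣-scale top⁻¹ g∣rh)
    where top⁻¹ = proj₁ (inverse (coeff r (length as)) top≢0)

  -- Euclid's lemma, by descent on the degree of a monic polynomial A with P ∣ A h:
  -- dividing P by A leaves either no remainder (A = 1, as P is irreducible) or a
  -- remainder r of smaller degree with P ∣ r h.
  module _ (ps : List C) (irr : Irreducibleᴸ ps) (h : Pol) where

    private
      P : Pol
      P = monicᴸ ps

      remainder-divisible : ∀ x y t r → r ≈ (x ⊕ neg (y ⊛ t)) → P ∣ (x ⊛ h) → P ∣ (y ⊛ h) → P ∣ (r ⊛ h)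
      remainder-divisible x y t r r≈ P∣xh P∣yh = ∣-congʳ (≈-sym rh≈) (∣-⊕ P∣xh (∣-neg (∣⇒∣⊛ˡ t P∣yh)))
        where
        rh≈ : (r ⊛ h) ≈ ((x ⊛ h) ⊕ neg (t ⊛ (y ⊛ h)))
        rh≈ = ≈-trans (⊛-congˡ h r≈) (≈-trans (⊛-distribʳ x (neg (y ⊛ t)) h)
               (⊕-cong ≈-refl (≈-trans (⊛-comm _ h) (≈-trans (⊛-negʳ h (y ⊛ t))
                 (neg-cong (≈-trans (⊛-comm h _) (≈-trans (⊛-congˡ h (⊛-comm y t)) (⊛-assoc t y h))))))))

      descent : ∀ n as → length as < n → length as < length ps → P ∣ (monicᴸ as ⊛ h) → P ∣ h
      descent n [] _ _ P∣h = ∣-congʳ (⊛-identityˡ h) P∣h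
      descent (suc n) (a ∷ as) (s≤s as<n) as<ps P∣Ah with divMod (a ∷ as) P
      ... | t , r , r<A , P≈At+r with ≈[]⊎Degree r
      ... | inj₁ r≈[] = ⊥-elim (proper-factor (monicᴸ-cofactor (a ∷ as) t ps (≈-sym P≈At)))
        where
        P≈At : P ≈ (monicᴸ (a ∷ as) ⊛ t)
        P≈At = ≈-trans P≈At+r (⊕-identityʳ _ r≈[])
        proper-factor : ¬ (Σ (List C) λ bs → (length (a ∷ as) + length bs ≡ length ps) × (t ≈ monicᴸ bs))
        proper-factor ([] , deg≡ , _) = ℕ.<-irrefl (trans (sym (ℕ.+-identityʳ _)) deg≡) as<ps
        proper-factor (b ∷ bs , _ , t≈B) =
          proj₂ irr (a ∷ as) (b ∷ bs) (s≤s z≤n) (s≤s z≤n) (≈-trans (⊛-congʳ (monicᴸ (a ∷ as)) (≈-sym t≈B)) (≈-sym P≈At))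
      ... | inj₂ (m , D) with monicᴸ-associate r m D
      ... | bs , refl , transfer = descent n bs (ℕ.≤-trans r<A' as<n) (ℕ.<-trans r<A' as<ps)
          (transfer h P (remainder-divisible P (monicᴸ (a ∷ as)) t r (≈-sym (≈-⊕⇒⊕neg P≈At+r)) (∣-⊛ʳ P h) P∣Ah))
        where
        r<A' : length bs < length (a ∷ as)
        r<A' = Degree-DegreeBelow⇒< D r<A

    euclid : ∀ a → P ∣ (a ⊛ h) → ¬ (P ∣ a) → P ∣ h
    euclid a P∣ah P∤a with divMod ps a
    ... | t , r , r<P , a≈Pt+r with ≈[]⊎Degree r
    ... | inj₁ r≈[] = ⊥-elim (P∤a (divides t (≈-trans a≈Pt+r (⊕-identityʳ _ r≈[]))))
    ... | inj₂ (m , D) with monicᴸ-associate r m D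
    ... | bs , refl , transfer = descent (suc (length ps)) bs (s≤s (ℕ.<⇒≤ r<P')) r<P'
          (transfer h P (remainder-divisible a P t r (≈-sym (≈-⊕⇒⊕neg a≈Pt+r)) P∣ah (∣-⊛ʳ P h)))
      where
      r<P' : length bs < length ps
      r<P' = Degree-DegreeBelow⇒< D r<P

  pow : Pol → ℕ → Pol
  pow p zero = 1# ∷ []
  pow p (suc j) = p ⊛ pow p j

  pow-monicᴸ : ∀ ps j → Σ (List C) λ cs → (length cs ≡ j * length ps) × (pow (monicᴸ ps) j ≈ monicᴸ cs)
  pow-monicᴸ ps zero = [] , refl , ≈-refl
  pow-monicᴸ ps (suc j) with pow-monicᴸ ps j
  ... | cs , cs≡ , e with monicᴸ⊛monicᴸ ps cs
  ... | ds , ds≡ , e' = ds , trans ds≡ (cong (length ps +_) cs≡) , ≈-trans (⊛-congʳ (monicᴸ ps) e) e'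

  pow∣monicᴸ⇒≤ : ∀ ps j fs → pow (monicᴸ ps) j ∣ monicᴸ fs → j * length ps ≤ length fs
  pow∣monicᴸ⇒≤ ps j fs d with pow-monicᴸ ps j
  ... | cs , deg≡ , e = subst (_≤ length fs) deg≡ (∣monicᴸ⇒length≤ cs fs (∣-congˡ e d))

  Irreducibleᴸ-∤ : ∀ qs ps → Irreducibleᴸ qs → Irreducibleᴸ ps → qs ≢ ps → ¬ (monicᴸ qs ∣ monicᴸ ps)
  Irreducibleᴸ-∤ qs ps iq ip qs≢ps (divides t e) with monicᴸ-cofactor qs t ps (≈-sym e)
  ... | [] , _ , t≈1 = qs≢ps (monicᴸ-injective (≈-trans (≈-sym (⊛-identityʳ (monicᴸ qs)))
                          (≈-trans (⊛-congʳ (monicᴸ qs) (≈-sym t≈1)) (≈-sym e))))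
  ... | b ∷ bs , _ , t≈B = proj₂ ip qs (b ∷ bs) (proj₁ iq) (s≤s z≤n) (≈-trans (⊛-congʳ (monicᴸ qs) (≈-sym t≈B)) (≈-sym e))

  pow∣⊛-coprime : ∀ qs ps → Irreducibleᴸ qs → Irreducibleᴸ ps → qs ≢ ps →
    ∀ j g → pow (monicᴸ qs) j ∣ (monicᴸ ps ⊛ g) → pow (monicᴸ qs) j ∣ g
  pow∣⊛-coprime qs ps iq ip qs≢ps zero g _ = 1∣ g
  pow∣⊛-coprime qs ps iq ip qs≢ps (suc j) g d
    with euclid qs iq g (monicᴸ ps) (∣-trans (∣-⊛ʳ (monicᴸ qs) _) d) (Irreducibleᴸ-∤ qs ps iq ip qs≢ps)
  ... | divides g' g≈Qg' =
    ∣-congʳ (≈-sym g≈Qg') (∣⇒⊛∣⊛ Q (pow∣⊛-coprime qs ps iq ip qs≢ps j g' (divides (quotient d) (monicᴸ-cancel qs Q⊛Pg'≈))))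
    where
    Q = monicᴸ qs
    P = monicᴸ ps
    Q⊛Pg'≈ : (Q ⊛ (P ⊛ g')) ≈ (Q ⊛ (pow Q j ⊛ quotient d))
    Q⊛Pg'≈ = ≈-trans (≈-sym (⊛-assoc Q P g')) (≈-trans (⊛-congˡ g' (⊛-comm Q P)) (≈-trans (⊛-assoc P Q g')
               (≈-trans (⊛-congʳ P (≈-sym g≈Qg')) (≈-trans (equation d) (⊛-assoc Q (pow Q j) _)))))

  pow-suc∣⊛⇔pow∣ : ∀ ps j g → (pow (monicᴸ ps) (suc j) ∣ (monicᴸ ps ⊛ g) → pow (monicᴸ ps) j ∣ g)
                             × (pow (monicᴸ ps) j ∣ g → pow (monicᴸ ps) (suc j) ∣ (monicᴸ ps ⊛ g))
  pow-suc∣⊛⇔pow∣ ps j g =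
    (λ { (divides t e) → divides t (monicᴸ-cancel ps (≈-trans e (⊛-assoc (monicᴸ ps) (pow (monicᴸ ps) j) t))) }) ,
    ∣⇒⊛∣⊛ (monicᴸ ps)

  length-⊕ : ∀ p q → length (p ⊕ q) ≡ length p ⊔ length q
  length-⊕ [] q = refl
  length-⊕ (x ∷ p) [] = sym (ℕ.⊔-identityʳ _)
  length-⊕ (x ∷ p) (y ∷ q) = cong suc (length-⊕ p q)

  length-⊛ : ∀ x xs y ys → length ((x ∷ xs) ⊛ (y ∷ ys)) ≡ length xs + suc (length ys)
  length-⊛ x [] y ys = trans (length-⊕ (scale x (y ∷ ys)) (0# ∷ [])) (trans (cong (_⊔ 1) (List.length-map (x ·_) (y ∷ ys))) (ℕ.m≥n⇒m⊔n≡m (s≤s z≤n)))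
  length-⊛ x (x' ∷ xs) y ys = trans (length-⊕ (scale x (y ∷ ys)) (0# ∷ ((x' ∷ xs) ⊛ (y ∷ ys))))
      (trans (cong₂ _⊔_ (List.length-map (x ·_) (y ∷ ys)) (cong suc (length-⊛ x' xs y ys)))
        (ℕ.m≤n⇒m⊔n≡n (s≤s (ℕ.≤-trans (ℕ.n≤1+n _) (ℕ.m≤n+m _ _)))))

  Irreducible⇒Irreducibleᴸ : ∀ d (v : Vec C d) → Irreducible d v → Irreducibleᴸ (toList v)
  Irreducible⇒Irreducibleᴸ d v (1≤d , no-factorization) = subst (1 ≤_) (sym (Vec.length-toList v)) 1≤d , factors
    where
    factors : ∀ as bs → 1 ≤ length as → 1 ≤ length bs → ¬ ((monicᴸ as ⊛ monicᴸ bs) ≈ monicᴸ (toList v))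
    factors (a ∷ as) (b ∷ bs) _ _ e = no-factorization (length as , length bs , deg≡ , fromList (a ∷ as) , fromList (b ∷ bs) , ≡monic)
      where
      deg≡ : suc (length as) + suc (length bs) ≡ d
      deg≡ = trans (sym (proj₁ (proj₂ cs))) (trans (cong length (monicᴸ-injective (≈-trans (≈-sym (proj₂ (proj₂ cs))) e))) (Vec.length-toList v))
        where cs = monicᴸ⊛monicᴸ (a ∷ as) (b ∷ bs)
      ≡monic : monic (fromList (a ∷ as)) ⊛ monic (fromList (b ∷ bs)) ≡ monic v
      ≡monic rewrite Vec.toList∘fromList as | Vec.toList∘fromList bs =
        ≈⇒≡ e (trans (length-⊛ a (monicᴸ as) b (monicᴸ bs))
          (trans (cong₂ (λ u w → u + suc w) (length-monicᴸ as) (length-monicᴸ bs))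
          (trans (cong suc (ℕ.+-suc (length as) (suc (length bs))))
          (trans (cong suc deg≡) (trans (sym (cong suc (Vec.length-toList v))) (sym (length-monicᴸ (toList v))))))))

  irreducible-factor : ∀ n fs → length fs < n → 1 ≤ length fs →
    Σ ℕ λ d → Σ (Vec C d) λ w → Irreducible d w × (monicᴸ (toList w) ∣ monicᴸ fs)
  irreducible-factor (suc n) fs fs<n 1≤fs with irreducible? (length fs) (fromList fs)
  ... | yes irr = length fs , fromList fs , irr , subst (λ z → monicᴸ z ∣ monicᴸ fs) (sym (Vec.toList∘fromList fs)) (∣-refl (monicᴸ fs))
  ... | no ¬irr with factorization? (length fs) (fromList fs)
  ...   | no ¬fac = ⊥-elim (¬irr (1≤fs , ¬fac))
  ...   | yes (a , b , deg≡ , g , h , gh≡) with irreducible-factor n (toList g) g<n (subst (1 ≤_) (sym (Vec.length-toList g)) (s≤s z≤n))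
    where
    g<n : length (toList g) < n
    g<n = subst (_< n) (sym (Vec.length-toList g)) (ℕ.<-≤-trans (subst (suc (suc a) ≤_) deg≡ (s≤s (ℕ.m<m+n a (s≤s z≤n)))) (ℕ.≤-pred fs<n))
  ...     | d , w , irr-w , w∣g = d , w , irr-w , ∣-trans w∣g (divides (monicᴸ (toList h)) fs≈gh)
    where
    fs≈gh : monicᴸ fs ≈ (monicᴸ (toList g) ⊛ monicᴸ (toList h))
    fs≈gh = ≈-reflexive (trans (cong monicᴸ (sym (Vec.toList∘fromList fs))) (sym gh≡))

-- Counting monic polynomials and Gauss's formula

-- The number of monic polynomials of degree n divisible by a given monic polynomial of degree m.
multiples : ℕ → ℕ → ℕ → ℕ
multiples q n m = 𝟙 (m ≤? n) * q ^ (n ∸ m)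

-- Σ_{j ≥ 1} #{monic f of degree n : P^j ∣ f} for a monic P of degree d.
powerMultiples : ℕ → ℕ → ℕ → ℕ
powerMultiples q n d = ∑ (range n) (λ j → multiples q n (suc j * d))

module Counting (F : FiniteField) where

  open FiniteField F renaming (Carrier to C) using (enum; size)
  open Polynomials F
  open Inverse enum using (to; from; strictlyInverseˡ; strictlyInverseʳ)
  open ≡-Reasoning

  private
    q = size

  _≟V_ : ∀ {d} → DecidableEquality (Vec C d)
  _≟V_ = Vec.≡-dec _≟C_

  _≟L_ : DecidableEquality (List C)
  _≟L_ = List.≡-dec _≟C_

  length-allVecs : ∀ d → length (allVecs d) ≡ q ^ d
  length-allVecs zero = refl
  length-allVecs (suc d) = begin
    length (allVecs (suc d))                                  ≡⟨ length≡∑1 (allVecs (suc d)) ⟩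
    ∑ (allVecs (suc d)) (λ _ → 1)                             ≡⟨ ∑-concatMap allC (λ x → map (x Vec.∷_) (allVecs d)) _ ⟩
    ∑ allC (λ x → ∑ (map (x Vec.∷_) (allVecs d)) (λ _ → 1))  ≡⟨ ∑-cong allC (λ x → trans (∑-map (allVecs d) (x Vec.∷_) _) (sym (length≡∑1 (allVecs d)))) ⟩
    ∑ allC (λ _ → length (allVecs d))                         ≡⟨ ∑-const allC _ ⟩
    length allC * length (allVecs d)                          ≡⟨ cong₂ _*_ length-allC (length-allVecs d) ⟩
    q * q ^ d                                                 ∎
    where
    length-allC : length allC ≡ q
    length-allC = trans (List.length-map from (allFin size)) (List.length-tabulate (λ i → i))

  ∑-allVecs-delta : ∀ d (w : Vec C d) → ∑ (allVecs d) (λ v → 𝟙 (v ≟V w)) ≡ 1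
  ∑-allVecs-delta zero Vec.[] = refl
  ∑-allVecs-delta (suc d) (x Vec.∷ w) = begin
    ∑ (allVecs (suc d)) (λ v → 𝟙 (v ≟V (x Vec.∷ w)))
      ≡⟨ ∑-concatMap allC (λ y → map (y Vec.∷_) (allVecs d)) _ ⟩
    ∑ allC (λ y → ∑ (map (y Vec.∷_) (allVecs d)) (λ v → 𝟙 (v ≟V (x Vec.∷ w))))
      ≡⟨ ∑-cong allC (λ y → trans (∑-map (allVecs d) (y Vec.∷_) _) (∑-cong (allVecs d) (λ v → 𝟙-∷ y v))) ⟩
    ∑ allC (λ y → ∑ (allVecs d) (λ v → 𝟙 (y ≟C x) * 𝟙 (v ≟V w)))
      ≡⟨ ∑-cong allC (λ y → trans (∑-*ˡ (allVecs d) (𝟙 (y ≟C x)) _) (trans (cong (𝟙 (y ≟C x) *_) (∑-allVecs-delta d w)) (ℕ.*-identityʳ _))) ⟩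
    ∑ allC (λ y → 𝟙 (y ≟C x))
      ≡⟨ ∑-allC-delta ⟩
    1 ∎
    where
    𝟙-∷ : ∀ y v → 𝟙 ((y Vec.∷ v) ≟V (x Vec.∷ w)) ≡ 𝟙 (y ≟C x) * 𝟙 (v ≟V w)
    𝟙-∷ y v = trans (𝟙-cong ((y Vec.∷ v) ≟V (x Vec.∷ w)) ((y ≟C x) ×-dec (v ≟V w)) Vec.∷-injective (λ { (refl , refl) → refl }))
                    (𝟙-× (y ≟C x) (v ≟V w))
    ∑-allC-delta : ∑ allC (λ y → 𝟙 (y ≟C x)) ≡ 1
    ∑-allC-delta = trans (∑-map (allFin size) from _)
      (trans (∑-cong (allFin size) (λ i → 𝟙-cong (from i ≟C x) (i Fin.≟ to x)
                       (λ e → trans (sym (strictlyInverseˡ i)) (cong to e))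
                       (λ e → trans (cong from e) (strictlyInverseʳ x))))
        (∑-allFin-delta size (to x)))

  ∑-allVecs-unique : ∀ d {P : Vec C d → Set} (P? : ∀ v → Dec (P v)) w → P w → (∀ v → P v → v ≡ w) →
    ∑ (allVecs d) (λ v → 𝟙 (P? v)) ≡ 1
  ∑-allVecs-unique d P? w Pw unique =
    trans (∑-cong (allVecs d) (λ v → 𝟙-cong (P? v) (v ≟V w) (unique v) (λ { refl → Pw }))) (∑-allVecs-delta d w)

  toList-surjective : ∀ m (l : List C) → length l ≡ m → Σ (Vec C m) λ u → toList u ≡ l
  toList-surjective zero [] _ = Vec.[] , refl
  toList-surjective (suc m) (x ∷ l) e with toList-surjective m l (ℕ.suc-injective e)
  ... | u , refl = x Vec.∷ u , refl

  toList-injective : ∀ {d} (u v : Vec C d) → toList u ≡ toList v → u ≡ v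
  toList-injective u v e = trans (sym (Vec.cast-is-id refl u)) (Vec.toList-injective refl u v e)

  -- Multiplication by monicᴸ gs is a bijection from monic polynomials of degree n - deg gs onto the monic multiples of degree n.
  count-multiples : ∀ gs n → ∑ (allVecs n) (λ v → 𝟙 (gs ∣? monicᴸ (toList v))) ≡ multiples q n (length gs)
  count-multiples gs n with length gs ≤? n
  ... | no gs≰n = ∑-𝟙-no (allVecs n) (λ v → gs ∣? monicᴸ (toList v))
      (λ v gs∣v → gs≰n (subst (length gs ≤_) (Vec.length-toList v) (∣monicᴸ⇒length≤ gs (toList v) gs∣v)))
  ... | yes gs≤n = begin
    ∑ (allVecs n) (λ v → 𝟙 (gs ∣? monicᴸ (toList v)))                ≡⟨ ∑-cong (allVecs n) cofactors ⟩
    ∑ (allVecs n) (λ v → ∑ (allVecs m) (λ u → 𝟙 (product u ≟L toList v)))  ≡⟨ ∑-comm (allVecs n) (allVecs m) _ ⟩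
    ∑ (allVecs m) (λ u → ∑ (allVecs n) (λ v → 𝟙 (product u ≟L toList v)))  ≡⟨ ∑-cong (allVecs m) products ⟩
    ∑ (allVecs m) (λ _ → 1)                                          ≡⟨ sym (length≡∑1 (allVecs m)) ⟩
    length (allVecs m)                                              ≡⟨ length-allVecs m ⟩
    q ^ m                                                           ≡⟨ sym (ℕ.*-identityˡ _) ⟩
    1 * q ^ m                                                       ∎
    where
    k = length gs
    m = n ∸ k
    product : Vec C m → List C
    product u = proj₁ (monicᴸ⊛monicᴸ gs (toList u))
    product-≈ : ∀ u → (monicᴸ gs ⊛ monicᴸ (toList u)) ≈ monicᴸ (product u)
    product-≈ u = proj₂ (proj₂ (monicᴸ⊛monicᴸ gs (toList u)))
    length-product : ∀ u → length (product u) ≡ n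
    length-product u = trans (proj₁ (proj₂ (monicᴸ⊛monicᴸ gs (toList u))))
      (trans (cong (k +_) (Vec.length-toList u)) (trans (ℕ.+-comm k m) (ℕ.m∸n+n≡m gs≤n)))
    cofactors : ∀ v → 𝟙 (gs ∣? monicᴸ (toList v)) ≡ ∑ (allVecs m) (λ u → 𝟙 (product u ≟L toList v))
    cofactors v with gs ∣? monicᴸ (toList v)
    ... | no gs∤v = sym (∑-𝟙-no (allVecs m) (λ u → product u ≟L toList v)
                      (λ u e → gs∤v (divides (monicᴸ (toList u)) (≈-sym (≈-trans (product-≈ u) (≈-reflexive (cong monicᴸ e)))))))
    ... | yes (divides t v≈Gt) with monicᴸ-cofactor gs t (toList v) (≈-sym v≈Gt)
    ... | bs , deg≡ , t≈B = sym (∑-allVecs-unique m (λ u → product u ≟L toList v) u₀ product-u₀ unique)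
      where
      u₀,u₀≡bs : Σ (Vec C m) λ u → toList u ≡ bs
      u₀,u₀≡bs = toList-surjective m bs (trans (sym (ℕ.m+n∸m≡n k (length bs))) (cong (_∸ k) (trans deg≡ (Vec.length-toList v))))
      u₀ : Vec C m
      u₀ = proj₁ u₀,u₀≡bs
      G⊛u₀≈v : (monicᴸ gs ⊛ monicᴸ (toList u₀)) ≈ monicᴸ (toList v)
      G⊛u₀≈v = ≈-trans (⊛-congʳ (monicᴸ gs) (≈-trans (≈-reflexive (cong monicᴸ (proj₂ u₀,u₀≡bs))) (≈-sym t≈B))) (≈-sym v≈Gt)
      product-u₀ : product u₀ ≡ toList v
      product-u₀ = monicᴸ-injective (≈-trans (≈-sym (product-≈ u₀)) G⊛u₀≈v)
      unique : ∀ u → product u ≡ toList v → u ≡ u₀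
      unique u e = toList-injective u u₀ (monicᴸ-injective (monicᴸ-cancel gs
        (≈-trans (≈-trans (product-≈ u) (≈-reflexive (cong monicᴸ e))) (≈-sym G⊛u₀≈v))))
    products : ∀ u → ∑ (allVecs n) (λ v → 𝟙 (product u ≟L toList v)) ≡ 1
    products u = ∑-allVecs-unique n (λ v → product u ≟L toList v) v₀ (sym (proj₂ v₀,v₀≡))
                   (λ v e → toList-injective v v₀ (trans (sym e) (sym (proj₂ v₀,v₀≡))))
      where
      v₀,v₀≡ : Σ (Vec C n) λ v → toList v ≡ product u
      v₀,v₀≡ = toList-surjective n (product u) (length-product u)
      v₀ : Vec C n
      v₀ = proj₁ v₀,v₀≡

  irreducibles : ∀ d → List (Vec C d)
  irreducibles d = filter (irreducible? d) (allVecs d)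

  pow∣? : ∀ ps j f → Dec (pow (monicᴸ ps) j ∣ f)
  pow∣? ps j f with pow-monicᴸ ps j
  ... | cs , _ , e = map′ (∣-congˡ (≈-sym e)) (∣-congˡ e) (cs ∣? f)

  valuation : ℕ → ∀ {d} → Vec C d → Pol → ℕ
  valuation N w f = ∑ (range N) (λ j → 𝟙 (pow∣? (toList w) (suc j) f))

  -- Λ N f = Σ_{P monic irreducible, deg P ≤ N} deg P · v_P(f), with the valuations v_P truncated at N.
  Λ : ℕ → Pol → ℕ
  Λ N f = ∑ (range (suc N)) (λ d → d * ∑ (irreducibles d) (λ w → valuation N w f))

  Λ-cong : ∀ N {f f'} → f ≈ f' → Λ N f ≡ Λ N f'
  Λ-cong N {f} {f'} e = ∑-cong (range (suc N)) λ d → cong (d *_) (∑-cong (irreducibles d) λ w → ∑-cong (range N) λ j →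
    𝟙-cong (pow∣? (toList w) (suc j) f) (pow∣? (toList w) (suc j) f') (∣-congʳ e) (∣-congʳ (≈-sym e)))

  Λ-one : ∀ N → Λ N (monicᴸ []) ≡ 0
  Λ-one N = ∑-zero (range (suc N)) vanishing
    where
    vanishing : ∀ d → d * ∑ (irreducibles d) (λ w → valuation N w (monicᴸ [])) ≡ 0
    vanishing zero = refl
    vanishing (suc d) = trans (cong (suc d *_) (∑-zero (irreducibles (suc d)) (λ w → ∑-zero (range N) (λ j →
      𝟙-no (pow∣? (toList w) (suc j) (monicᴸ [])) (λ w∣1 → too-big w j (pow∣monicᴸ⇒≤ (toList w) (suc j) [] w∣1))))))
      (ℕ.*-zeroʳ (suc d))
      where
      too-big : ∀ (w : Vec C (suc d)) j → ¬ (suc j * length (toList w) ≤ 0)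
      too-big w j le with length (toList w) | Vec.length-toList w
      ... | .(suc d) | refl with le
      ... | ()

  valuation-self-⊛ : ∀ ps gs N → 1 ≤ length ps → length gs < N →
    ∑ (range N) (λ j → 𝟙 (pow∣? ps (suc j) (monicᴸ ps ⊛ monicᴸ gs))) ≡ ∑ (range N) (λ j → 𝟙 (pow∣? ps (suc j) (monicᴸ gs))) + 1
  valuation-self-⊛ ps gs (suc N) 1≤ps gs<N = begin
    ∑ (range (suc N)) (λ j → 𝟙 (pow∣? ps (suc j) (monicᴸ ps ⊛ monicᴸ gs)))
      ≡⟨ ∑-cong (range (suc N)) (λ j → 𝟙-cong (pow∣? ps (suc j) (monicᴸ ps ⊛ monicᴸ gs)) (pow∣? ps j (monicᴸ gs))
                                               (proj₁ (pow-suc∣⊛⇔pow∣ ps j (monicᴸ gs))) (proj₂ (pow-suc∣⊛⇔pow∣ ps j (monicᴸ gs)))) ⟩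
    ∑ (range (suc N)) v                              ≡⟨ ∑-range-suc N v ⟩
    v 0 + ∑ (range N) (v ∘ suc)                      ≡⟨ cong (_+ ∑ (range N) (v ∘ suc)) (𝟙-yes (pow∣? ps 0 (monicᴸ gs)) (1∣ (monicᴸ gs))) ⟩
    1 + ∑ (range N) (v ∘ suc)                        ≡⟨ ℕ.+-comm 1 _ ⟩
    ∑ (range N) (v ∘ suc) + 1                        ≡⟨ cong (_+ 1) (sym (ℕ.+-identityʳ _)) ⟩
    ∑ (range N) (v ∘ suc) + 0 + 1                    ≡⟨ cong (λ z → ∑ (range N) (v ∘ suc) + z + 1) (sym v[N+1]≡0) ⟩
    ∑ (range N) (v ∘ suc) + v (suc N) + 1            ≡⟨ cong (_+ 1) (sym (∑-range-last N (v ∘ suc))) ⟩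
    ∑ (range (suc N)) (v ∘ suc) + 1                  ∎
    where
    v : ℕ → ℕ
    v j = 𝟙 (pow∣? ps j (monicᴸ gs))
    v[N+1]≡0 : v (suc N) ≡ 0
    v[N+1]≡0 = 𝟙-no (pow∣? ps (suc N) (monicᴸ gs)) λ P^N+1∣G →
      ℕ.<⇒≱ (ℕ.<-≤-trans gs<N (ℕ.m≤m*n (suc N) (length ps) {{>-nonZero 1≤ps}})) (pow∣monicᴸ⇒≤ ps (suc N) gs P^N+1∣G)

  valuation-irreducible-⊛ : ∀ ps gs N → Irreducibleᴸ ps → length gs < N → ∀ d (w : Vec C d) → Irreducible d w →
    valuation N w (monicᴸ ps ⊛ monicᴸ gs) ≡ valuation N w (monicᴸ gs) + 𝟙 (toList w ≟L ps)
  valuation-irreducible-⊛ ps gs N irr-ps gs<N d w irr-w with toList w ≟L ps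
  ... | yes refl = valuation-self-⊛ ps gs N (proj₁ irr-ps) gs<N
  ... | no w≢ps = trans (∑-cong (range N) λ j →
          𝟙-cong (pow∣? (toList w) (suc j) (monicᴸ ps ⊛ monicᴸ gs)) (pow∣? (toList w) (suc j) (monicᴸ gs))
                 (pow∣⊛-coprime (toList w) ps (Irreducible⇒Irreducibleᴸ d w irr-w) irr-ps w≢ps (suc j) (monicᴸ gs))
                 (∣⇒∣⊛ˡ (monicᴸ ps)))
        (sym (ℕ.+-identityʳ _))

  ∑-irreducibles-delta : ∀ d₀ (w₀ : Vec C d₀) → Irreducible d₀ w₀ →
    ∀ d → ∑ (irreducibles d) (λ w → 𝟙 (toList w ≟L toList w₀)) ≡ 𝟙 (d ℕ.≟ d₀)
  ∑-irreducibles-delta d₀ w₀ irr-w₀ d with d ℕ.≟ d₀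
  ... | no d≢d₀ = ∑-𝟙-no (irreducibles d) (λ w → toList w ≟L toList w₀)
        (λ w e → d≢d₀ (trans (sym (Vec.length-toList w)) (trans (cong length e) (Vec.length-toList w₀))))
  ... | yes refl = begin
    ∑ (irreducibles d) (λ w → 𝟙 (toList w ≟L toList w₀))
      ≡⟨ ∑-filter (irreducible? d) (allVecs d) _ ⟩
    ∑ (allVecs d) (λ w → 𝟙 (irreducible? d w) * 𝟙 (toList w ≟L toList w₀))
      ≡⟨ ∑-cong (allVecs d) (λ w → sym (𝟙-× (irreducible? d w) (toList w ≟L toList w₀))) ⟩
    ∑ (allVecs d) (λ w → 𝟙 (irreducible? d w ×-dec (toList w ≟L toList w₀)))
      ≡⟨ ∑-allVecs-unique d (λ w → irreducible? d w ×-dec (toList w ≟L toList w₀)) w₀ (irr-w₀ , refl) (λ w p → toList-injective w w₀ (proj₂ p)) ⟩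
    1 ∎

  Λ-irreducible-⊛ : ∀ N d₀ (w₀ : Vec C d₀) → Irreducible d₀ w₀ → ∀ gs → length gs < N → d₀ ≤ N →
    Λ N (monicᴸ (toList w₀) ⊛ monicᴸ gs) ≡ Λ N (monicᴸ gs) + d₀
  Λ-irreducible-⊛ N d₀ w₀ irr-w₀ gs gs<N d₀≤N = begin
    Λ N (P₀ ⊛ monicᴸ gs)
      ≡⟨ ∑-cong (range (suc N)) (λ d → cong (d *_) (∑-filter-cong (irreducible? d) (allVecs d)
           (λ w irr-w → valuation-irreducible-⊛ ps₀ gs N (Irreducible⇒Irreducibleᴸ d₀ w₀ irr-w₀) gs<N d w irr-w))) ⟩
    ∑ (range (suc N)) (λ d → d * ∑ (irreducibles d) (λ w → valuation N w (monicᴸ gs) + δ w))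
      ≡⟨ ∑-cong (range (suc N)) (λ d → trans (cong (d *_) (∑-distrib-+ (irreducibles d) (λ w → valuation N w (monicᴸ gs)) δ)) (ℕ.*-distribˡ-+ d _ _)) ⟩
    ∑ (range (suc N)) (λ d → d * ∑ (irreducibles d) (λ w → valuation N w (monicᴸ gs)) + d * ∑ (irreducibles d) δ)
      ≡⟨ ∑-distrib-+ (range (suc N)) (λ d → d * ∑ (irreducibles d) (λ w → valuation N w (monicᴸ gs))) (λ d → d * ∑ (irreducibles d) δ) ⟩
    Λ N (monicᴸ gs) + ∑ (range (suc N)) (λ d → d * ∑ (irreducibles d) δ)
      ≡⟨ cong (Λ N (monicᴸ gs) +_) (∑-cong (range (suc N)) (λ d → trans (cong (d *_) (∑-irreducibles-delta d₀ w₀ irr-w₀ d)) (ℕ.*-comm d _))) ⟩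
    Λ N (monicᴸ gs) + ∑ (range (suc N)) (λ d → 𝟙 (d ℕ.≟ d₀) * d)
      ≡⟨ cong (Λ N (monicᴸ gs) +_) (∑-range-delta (suc N) d₀ (λ d → d) (s≤s d₀≤N)) ⟩
    Λ N (monicᴸ gs) + d₀ ∎
    where
    ps₀ = toList w₀
    P₀ = monicᴸ ps₀
    δ : ∀ {d} → Vec C d → ℕ
    δ w = 𝟙 (toList w ≟L ps₀)

  Λ-monicᴸ : ∀ N fs → length fs ≤ N → Λ N (monicᴸ fs) ≡ length fs
  Λ-monicᴸ N fs = go (suc (length fs)) fs ℕ.≤-refl
    where
    go : ∀ n fs → length fs < n → length fs ≤ N → Λ N (monicᴸ fs) ≡ length fs
    go n [] _ _ = Λ-one N
    go (suc n) fs@(_ ∷ _) (s≤s fs≤n) fs≤N = peel (irreducible-factor (suc (length fs)) fs ℕ.≤-refl (s≤s z≤n))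
      where
      peel : (Σ ℕ λ d → Σ (Vec C d) λ w → Irreducible d w × (monicᴸ (toList w) ∣ monicᴸ fs)) → Λ N (monicᴸ fs) ≡ length fs
      peel (d₀ , w₀ , irr-w₀ , divides t fs≈P₀t) = begin
        Λ N (monicᴸ fs)                           ≡⟨ Λ-cong N (≈-trans fs≈P₀t (⊛-congʳ (monicᴸ (toList w₀)) t≈G)) ⟩
        Λ N (monicᴸ (toList w₀) ⊛ monicᴸ gs)      ≡⟨ Λ-irreducible-⊛ N d₀ w₀ irr-w₀ gs gs<N d₀≤N ⟩
        Λ N (monicᴸ gs) + d₀                      ≡⟨ cong (_+ d₀) (go n gs (ℕ.<-≤-trans gs<fs fs≤n) (ℕ.<⇒≤ gs<N)) ⟩
        length gs + d₀                            ≡⟨ ℕ.+-comm (length gs) d₀ ⟩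
        d₀ + length gs                            ≡⟨ trans (cong (_+ length gs) (sym (Vec.length-toList w₀))) deg≡ ⟩
        length fs                                 ∎
        where
        cofactor : Σ (List C) λ gs → (length (toList w₀) + length gs ≡ length fs) × (t ≈ monicᴸ gs)
        cofactor = monicᴸ-cofactor (toList w₀) t fs (≈-sym fs≈P₀t)
        gs : List C
        gs = proj₁ cofactor
        deg≡ : length (toList w₀) + length gs ≡ length fs
        deg≡ = proj₁ (proj₂ cofactor)
        t≈G : t ≈ monicᴸ gs
        t≈G = proj₂ (proj₂ cofactor)
        gs<fs : length gs < length fs
        gs<fs = subst (length gs <_) deg≡ (ℕ.+-monoˡ-≤ (length gs) (proj₁ (Irreducible⇒Irreducibleᴸ d₀ w₀ irr-w₀)))
        gs<N : length gs < N
        gs<N = ℕ.<-≤-trans gs<fs fs≤N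
        d₀≤N : d₀ ≤ N
        d₀≤N = ℕ.≤-trans (subst (_≤ length fs) (Vec.length-toList w₀) (subst (length (toList w₀) ≤_) deg≡ (ℕ.m≤m+n _ _))) fs≤N

  count-power-multiples : ∀ n d (w : Vec C d) j → ∑ (allVecs n) (λ v → 𝟙 (pow∣? (toList w) (suc j) (monicᴸ (toList v)))) ≡ multiples q n (suc j * d)
  count-power-multiples n d w j with pow-monicᴸ (toList w) (suc j)
  ... | cs , cs≡ , e = begin
    ∑ (allVecs n) (λ v → 𝟙 (pow∣? (toList w) (suc j) (monicᴸ (toList v))))
      ≡⟨ ∑-cong (allVecs n) (λ v → 𝟙-cong (pow∣? (toList w) (suc j) (monicᴸ (toList v))) (cs ∣? monicᴸ (toList v)) (∣-congˡ e) (∣-congˡ (≈-sym e))) ⟩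
    ∑ (allVecs n) (λ v → 𝟙 (cs ∣? monicᴸ (toList v)))
      ≡⟨ count-multiples cs n ⟩
    multiples q n (length cs)
      ≡⟨ cong (multiples q n) (trans cs≡ (cong (suc j *_) (Vec.length-toList w))) ⟩
    multiples q n (suc j * d) ∎

  -- Double counting the pairs (f, P^j) with f monic of degree n and P^j ∣ f, weighted by deg P.
  ∑-degree-powerMultiples : ∀ n → ∑ (range (suc n)) (λ d → d * (E F d * powerMultiples q n d)) ≡ q ^ n * n
  ∑-degree-powerMultiples n = begin
    ∑ (range (suc n)) (λ d → d * (E F d * powerMultiples q n d))
      ≡⟨ ∑-cong (range (suc n)) (λ d → cong (d *_) (sym (count-valuations d))) ⟩
    ∑ (range (suc n)) (λ d → d * ∑ (allVecs n) (λ v → ∑ (irreducibles d) (λ w → valuation n w (monicᴸ (toList v)))))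
      ≡⟨ ∑-cong (range (suc n)) (λ d → sym (∑-*ˡ (allVecs n) d _)) ⟩
    ∑ (range (suc n)) (λ d → ∑ (allVecs n) (λ v → d * ∑ (irreducibles d) (λ w → valuation n w (monicᴸ (toList v)))))
      ≡⟨ ∑-comm (range (suc n)) (allVecs n) _ ⟩
    ∑ (allVecs n) (λ v → Λ n (monicᴸ (toList v)))
      ≡⟨ ∑-cong (allVecs n) (λ v → trans (Λ-monicᴸ n (toList v) (ℕ.≤-reflexive (Vec.length-toList v))) (Vec.length-toList v)) ⟩
    ∑ (allVecs n) (λ _ → n)
      ≡⟨ ∑-const (allVecs n) n ⟩
    length (allVecs n) * n
      ≡⟨ cong (_* n) (length-allVecs n) ⟩
    q ^ n * n ∎
    where
    count-valuations : ∀ d → ∑ (allVecs n) (λ v → ∑ (irreducibles d) (λ w → valuation n w (monicᴸ (toList v)))) ≡ E F d * powerMultiples q n d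
    count-valuations d = begin
      ∑ (allVecs n) (λ v → ∑ (irreducibles d) (λ w → ∑ (range n) (λ j → 𝟙 (pow∣? (toList w) (suc j) (monicᴸ (toList v))))))
        ≡⟨ ∑-comm (allVecs n) (irreducibles d) _ ⟩
      ∑ (irreducibles d) (λ w → ∑ (allVecs n) (λ v → ∑ (range n) (λ j → 𝟙 (pow∣? (toList w) (suc j) (monicᴸ (toList v))))))
        ≡⟨ ∑-cong (irreducibles d) (λ w → ∑-comm (allVecs n) (range n) _) ⟩
      ∑ (irreducibles d) (λ w → ∑ (range n) (λ j → ∑ (allVecs n) (λ v → 𝟙 (pow∣? (toList w) (suc j) (monicᴸ (toList v))))))
        ≡⟨ ∑-cong (irreducibles d) (λ w → ∑-cong (range n) (count-power-multiples n d w)) ⟩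
      ∑ (irreducibles d) (λ _ → powerMultiples q n d)
        ≡⟨ ∑-const (irreducibles d) _ ⟩
      E F d * powerMultiples q n d ∎

properDivisor? : ∀ m d → Dec ((1 ≤ d) × (d Div.∣ m))
properDivisor? m d = (1 ≤? d) ×-dec (d Div.∣? m)

sum-properDivisors : ∀ m f → sum (map f (properDivisors m)) ≡ ∑ (range m) (λ d → 𝟙 (properDivisor? m d) * f d)
sum-properDivisors m f = begin
  sum (map f (properDivisors m))                             ≡⟨ sym (∑≡sum∘map (properDivisors m) f) ⟩
  ∑ (filter (properDivisor? m) (upTo m)) f                   ≡⟨ ∑-filter (properDivisor? m) (upTo m) f ⟩
  ∑ (upTo m) (λ d → 𝟙 (properDivisor? m d) * f d)            ≡⟨ cong (λ xs → ∑ xs (λ d → 𝟙 (properDivisor? m d) * f d)) (upTo≡range m) ⟩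
  ∑ (range m) (λ d → 𝟙 (properDivisor? m d) * f d)           ∎
  where open ≡-Reasoning

quotientCount : ℕ → ℕ → ℕ
quotientCount m d = ∑ (range m) (λ j → 𝟙 (suc j * d ℕ.≟ m))

quotientCount≡𝟙∣ : ∀ m d → 1 ≤ m → 1 ≤ d → quotientCount m d ≡ 𝟙 (d Div.∣? m)
quotientCount≡𝟙∣ m d 1≤m 1≤d with d Div.∣? m
... | no d∤m = ∑-range-zero m _ (λ j _ → 𝟙-no (suc j * d ℕ.≟ m) (λ e → d∤m (Div.divides (suc j) (sym e))))
... | yes (Div.divides zero m≡0) = ⊥-elim (ℕ.<⇒≱ 1≤m (ℕ.≤-reflexive m≡0))
... | yes (Div.divides (suc k) m≡[1+k]d) = trans (∑-range-cong m only-k) (∑-range-delta m k (λ _ → 1) k<m)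
  where
  instance
    _ : NonZero d
    _ = >-nonZero 1≤d
  only-k : ∀ j → j < m → 𝟙 (suc j * d ℕ.≟ m) ≡ 𝟙 (j ℕ.≟ k) * 1
  only-k j _ = trans (𝟙-cong (suc j * d ℕ.≟ m) (j ℕ.≟ k)
                        (λ e → ℕ.suc-injective (ℕ.*-cancelʳ-≡ (suc j) (suc k) d (trans e m≡[1+k]d)))
                        (λ e → trans (cong (λ z → suc z * d) e) (sym m≡[1+k]d)))
                     (sym (ℕ.*-identityʳ _))
  k<m : k < m
  k<m = subst (k <_) (sym m≡[1+k]d) (ℕ.<-≤-trans (ℕ.n<1+n k) (ℕ.m≤m*n (suc k) d))

multiples-beyond : ∀ q n m → n < m → multiples q n m ≡ 0
multiples-beyond q n m n<m = cong (_* q ^ (n ∸ m)) (𝟙-no (m ≤? n) (ℕ.<⇒≱ n<m))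

multiples-suc : ∀ q n m → multiples q (suc n) m ≡ q * multiples q n m + 𝟙 (m ℕ.≟ suc n)
multiples-suc q n m with ℕ.<-cmp m (suc n)
... | tri< (s≤s m≤n) m≢1+n _ = begin
  𝟙 (m ≤? suc n) * q ^ (suc n ∸ m)          ≡⟨ cong₂ _*_ (𝟙-yes (m ≤? suc n) (ℕ.m≤n⇒m≤1+n m≤n)) (cong (q ^_) (ℕ.+-∸-assoc 1 m≤n)) ⟩
  1 * (q * q ^ (n ∸ m))                     ≡⟨ shuffle q (q ^ (n ∸ m)) ⟩
  q * (1 * q ^ (n ∸ m)) + 0                 ≡⟨ cong₂ (λ a b → q * (a * q ^ (n ∸ m)) + b) (sym (𝟙-yes (m ≤? n) m≤n)) (sym (𝟙-no (m ℕ.≟ suc n) m≢1+n)) ⟩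
  q * multiples q n m + 𝟙 (m ℕ.≟ suc n)     ∎
  where
  open ≡-Reasoning
  shuffle : ∀ q x → 1 * (q * x) ≡ q * (1 * x) + 0
  shuffle = solve-∀
... | tri≈ _ refl _ = begin
  𝟙 (suc n ≤? suc n) * q ^ (n ∸ n)          ≡⟨ cong₂ _*_ (𝟙-yes (suc n ≤? suc n) ℕ.≤-refl) (cong (q ^_) (ℕ.n∸n≡0 n)) ⟩
  1                                         ≡⟨ cong₂ _+_ (sym q*0≡0) (sym (𝟙-yes (suc n ℕ.≟ suc n) refl)) ⟩
  q * multiples q n (suc n) + 𝟙 (suc n ℕ.≟ suc n) ∎
  where
  open ≡-Reasoning
  q*0≡0 : q * multiples q n (suc n) ≡ 0
  q*0≡0 = trans (cong (q *_) (multiples-beyond q n (suc n) (ℕ.n<1+n n))) (ℕ.*-zeroʳ q)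
... | tri> _ m≢1+n 1+n<m = begin
  multiples q (suc n) m                     ≡⟨ multiples-beyond q (suc n) m 1+n<m ⟩
  0                                         ≡⟨ sym (cong₂ _+_ q*0≡0 (𝟙-no (m ℕ.≟ suc n) m≢1+n)) ⟩
  q * multiples q n m + 𝟙 (m ℕ.≟ suc n)     ∎
  where
  open ≡-Reasoning
  q*0≡0 : q * multiples q n m ≡ 0
  q*0≡0 = trans (cong (q *_) (multiples-beyond q n m (ℕ.<-trans (ℕ.n<1+n n) 1+n<m))) (ℕ.*-zeroʳ q)

powerMultiples-suc : ∀ q n d → 1 ≤ d → powerMultiples q (suc n) d ≡ q * powerMultiples q n d + quotientCount (suc n) d
powerMultiples-suc q n d 1≤d = begin
  ∑ (range (suc n)) (λ j → multiples q (suc n) (suc j * d))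
    ≡⟨ ∑-cong (range (suc n)) (λ j → multiples-suc q n (suc j * d)) ⟩
  ∑ (range (suc n)) (λ j → q * multiples q n (suc j * d) + 𝟙 (suc j * d ℕ.≟ suc n))
    ≡⟨ ∑-distrib-+ (range (suc n)) (λ j → q * multiples q n (suc j * d)) (λ j → 𝟙 (suc j * d ℕ.≟ suc n)) ⟩
  ∑ (range (suc n)) (λ j → q * multiples q n (suc j * d)) + quotientCount (suc n) d
    ≡⟨ cong (_+ quotientCount (suc n) d) (∑-*ˡ (range (suc n)) q (λ j → multiples q n (suc j * d))) ⟩
  q * ∑ (range (suc n)) (λ j → multiples q n (suc j * d)) + quotientCount (suc n) d
    ≡⟨ cong (λ z → q * z + quotientCount (suc n) d) (∑-range-last n (λ j → multiples q n (suc j * d))) ⟩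
  q * (powerMultiples q n d + multiples q n (suc n * d)) + quotientCount (suc n) d
    ≡⟨ cong (λ z → q * (powerMultiples q n d + z) + quotientCount (suc n) d) (multiples-beyond q n (suc n * d) n<[1+n]d) ⟩
  q * (powerMultiples q n d + 0) + quotientCount (suc n) d
    ≡⟨ cong (λ z → q * z + quotientCount (suc n) d) (ℕ.+-identityʳ _) ⟩
  q * powerMultiples q n d + quotientCount (suc n) d ∎
  where
  open ≡-Reasoning
  n<[1+n]d : n < suc n * d
  n<[1+n]d = ℕ.<-≤-trans (ℕ.n<1+n n) (ℕ.m≤m*n (suc n) d {{>-nonZero 1≤d}})

powerMultiples-beyond : ∀ q n → powerMultiples q n (suc n) ≡ 0
powerMultiples-beyond q n = ∑-range-zero n _ (λ j _ → multiples-beyond q n (suc j * suc n) (ℕ.<-≤-trans (ℕ.n<1+n n) (ℕ.m≤n*m (suc n) (suc j))))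

module _ (q : ℕ) (E : ℕ → ℕ) where

  divisorSum : ℕ → ℕ
  divisorSum m = ∑ (range (suc m)) (λ d → d * (E d * quotientCount m d))

  divisorSum≡ : ∀ m → 1 ≤ m → divisorSum m ≡ sum (map (λ d → d * E d) (properDivisors m)) + m * E m
  divisorSum≡ m 1≤m = begin
    divisorSum m
      ≡⟨ ∑-range-last m (λ d → d * (E d * quotientCount m d)) ⟩
    ∑ (range m) (λ d → d * (E d * quotientCount m d)) + m * (E m * quotientCount m m)
      ≡⟨ cong₂ _+_ (∑-cong (range m) proper) (cong (λ z → m * (E m * z)) (trans (quotientCount≡𝟙∣ m m 1≤m 1≤m) (𝟙-yes (m Div.∣? m) Div.∣-refl))) ⟩
    ∑ (range m) (λ d → 𝟙 (properDivisor? m d) * (d * E d)) + m * (E m * 1)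
      ≡⟨ cong₂ _+_ (sym (sum-properDivisors m (λ d → d * E d))) (cong (m *_) (ℕ.*-identityʳ (E m))) ⟩
    sum (map (λ d → d * E d) (properDivisors m)) + m * E m ∎
    where
    open ≡-Reasoning
    proper : ∀ d → d * (E d * quotientCount m d) ≡ 𝟙 (properDivisor? m d) * (d * E d)
    proper zero = sym (ℕ.*-zeroʳ (𝟙 (properDivisor? m zero)))
    proper (suc d) = begin
      suc d * (E (suc d) * quotientCount m (suc d))  ≡⟨ cong (λ z → suc d * (E (suc d) * z)) (quotientCount≡𝟙∣ m (suc d) 1≤m (s≤s z≤n)) ⟩
      suc d * (E (suc d) * 𝟙 (suc d Div.∣? m))           ≡⟨ rearrange (suc d) (E (suc d)) (𝟙 (suc d Div.∣? m)) ⟩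
      𝟙 (suc d Div.∣? m) * (suc d * E (suc d))           ≡⟨ cong (_* (suc d * E (suc d))) (𝟙-cong (suc d Div.∣? m) (properDivisor? m (suc d)) (s≤s z≤n ,_) proj₂) ⟩
      𝟙 (properDivisor? m (suc d)) * (suc d * E (suc d)) ∎
      where
      rearrange : ∀ a b c → a * (b * c) ≡ c * (a * b)
      rearrange = solve-∀

  -- Comparing the degree identity at n and n + 1 through powerMultiples-suc leaves exactly divisorSum (n + 1).
  degreeIdentity⇒divisorSum : (∀ n → ∑ (range (suc n)) (λ d → d * (E d * powerMultiples q n d)) ≡ q ^ n * n) →
    ∀ n → divisorSum (suc n) ≡ q ^ suc n
  degreeIdentity⇒divisorSum identity n = ℕ.+-cancelʳ-≡ (q * (q ^ n * n)) (divisorSum (suc n)) (q ^ suc n) (begin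
    divisorSum (suc n) + q * (q ^ n * n)
      ≡⟨ ℕ.+-comm (divisorSum (suc n)) _ ⟩
    q * (q ^ n * n) + divisorSum (suc n)
      ≡⟨ cong (λ z → q * z + divisorSum (suc n)) (sym ∑term≡) ⟩
    q * ∑ (range (suc (suc n))) term + divisorSum (suc n)
      ≡⟨ cong (_+ divisorSum (suc n)) (sym (∑-*ˡ (range (suc (suc n))) q term)) ⟩
    ∑ (range (suc (suc n))) (λ d → q * term d) + divisorSum (suc n)
      ≡⟨ sym (∑-distrib-+ (range (suc (suc n))) (λ d → q * term d) (λ d → d * (E d * quotientCount (suc n) d))) ⟩
    ∑ (range (suc (suc n))) (λ d → q * term d + d * (E d * quotientCount (suc n) d))
      ≡⟨ sym (∑-cong (range (suc (suc n))) term-suc) ⟩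
    ∑ (range (suc (suc n))) (λ d → d * (E d * powerMultiples q (suc n) d))
      ≡⟨ identity (suc n) ⟩
    q ^ suc n * suc n
      ≡⟨ expand q (q ^ n) n ⟩
    q ^ suc n + q * (q ^ n * n) ∎)
    where
    open ≡-Reasoning
    term : ℕ → ℕ
    term d = d * (E d * powerMultiples q n d)
    top≡0 : term (suc n) ≡ 0
    top≡0 = trans (cong (λ z → suc n * (E (suc n) * z)) (powerMultiples-beyond q n)) (trans (cong (suc n *_) (ℕ.*-zeroʳ (E (suc n)))) (ℕ.*-zeroʳ (suc n)))
    ∑term≡ : ∑ (range (suc (suc n))) term ≡ q ^ n * n
    ∑term≡ = trans (∑-range-last (suc n) term) (trans (cong (∑ (range (suc n)) term +_) top≡0) (trans (ℕ.+-identityʳ _) (identity n)))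
    term-suc : ∀ d → d * (E d * powerMultiples q (suc n) d) ≡ q * term d + d * (E d * quotientCount (suc n) d)
    term-suc zero = sym (cong (_+ 0) (ℕ.*-zeroʳ q))
    term-suc (suc d) = trans (cong (λ z → suc d * (E (suc d) * z)) (powerMultiples-suc q n (suc d) (s≤s z≤n)))
                         (distribute (suc d) (E (suc d)) q (powerMultiples q n (suc d)) (quotientCount (suc n) (suc d)))
      where
      distribute : ∀ d e q t x → d * (e * (q * t + x)) ≡ q * (d * (e * t)) + d * (e * x)
      distribute = solve-∀
    expand : ∀ q x n → (q * x) * suc n ≡ q * x + q * (x * n)
    expand = solve-∀

-- The order of a finite field

module FieldOrder (F : FiniteField) where

  open FiniteField F renaming (Carrier to C) using (1≢0; enum; size)
  open Polynomials F
  open Inverse enum using (to; from; strictlyInverseˡ; strictlyInverseʳ)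
  open SemiringMult (CommutativeRing.semiring fieldRing) using (×-homo-+; ×1-homo-*) renaming (_×_ to _⨯_)

  InjectiveBelow : (ℕ → C) → ℕ → Set
  InjectiveBelow f n = ∀ i j → i < n → j < n → f i ≡ f j → i ≡ j

  to-injective : ∀ {x y} → to x ≡ to y → x ≡ y
  to-injective {x} {y} e = trans (sym (strictlyInverseʳ x)) (trans (cong from e) (strictlyInverseʳ y))

  injective⇒≤size : ∀ (f : ℕ → C) n → InjectiveBelow f n → n ≤ size
  injective⇒≤size f n injective with size ℕ.<? n
  ... | no size≮n = ℕ.≮⇒≥ size≮n
  ... | yes size<n with Fin.pigeonhole size<n (λ i → to (f (toℕ i)))
  ...   | i , j , i<j , e = ⊥-elim (ℕ.<⇒≢ i<j (injective (toℕ i) (toℕ j) (Fin.toℕ<n i) (Fin.toℕ<n j) (to-injective e)))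

  from-injective : ∀ {i j} → from i ≡ from j → i ≡ j
  from-injective {i} {j} e = trans (sym (strictlyInverseˡ i)) (trans (cong to e) (strictlyInverseˡ j))

  surjective⇒size≤ : ∀ (f : ℕ → C) m → (∀ x → Σ (Fin m) λ k → f (toℕ k) ≡ x) → size ≤ m
  surjective⇒size≤ f m cover with m ℕ.<? size
  ... | no m≮size = ℕ.≮⇒≥ m≮size
  ... | yes m<size with Fin.pigeonhole m<size (λ i → proj₁ (cover (from i)))
  ...   | i , j , i<j , e = ⊥-elim (ℕ.<⇒≢ i<j (cong toℕ (from-injective from-i≡from-j)))
    where
    from-i≡from-j : from i ≡ from j
    from-i≡from-j = trans (sym (proj₂ (cover (from i)))) (trans (cong (λ k → f (toℕ k)) e) (proj₂ (cover (from j))))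

  outside-image : ∀ (f : ℕ → C) m → m < size → Σ C λ b → ∀ k → k < m → f k ≢ b
  outside-image f m m<size with decΣC (λ x → ¬ Covered x) (λ x → ¬? (covered? x))
    where
    Covered : C → Set
    Covered x = Σ (Fin m) λ k → f (toℕ k) ≡ x
    covered? : ∀ x → Dec (Covered x)
    covered? x = Fin.any? (λ k → f (toℕ k) ≟C x)
  ... | yes (b , uncovered) = b , λ k k<m fk≡b → uncovered (fromℕ< k<m , trans (cong f (Fin.toℕ-fromℕ< k<m)) fk≡b)
  ... | no none-uncovered = ⊥-elim (ℕ.<⇒≱ m<size (surjective⇒size≤ f m cover))
    where
    cover : ∀ x → Σ (Fin m) λ k → f (toℕ k) ≡ x
    cover x with Fin.any? (λ k → f (toℕ k) ≟C x)
    ... | yes covered = covered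
    ... | no uncovered = ⊥-elim (none-uncovered (x , uncovered))

  2≤size : 2 ≤ size
  2≤size = injective⇒≤size bit 2 injective
    where
    bit : ℕ → C
    bit zero = 0#
    bit (suc _) = 1#
    injective : InjectiveBelow bit 2
    injective zero zero _ _ _ = refl
    injective zero (suc zero) _ _ 0≡1 = ⊥-elim (1≢0 (sym 0≡1))
    injective (suc zero) zero _ _ 1≡0 = ⊥-elim (1≢0 1≡0)
    injective (suc zero) (suc zero) _ _ _ = refl
    injective _ (suc (suc _)) _ (s≤s (s≤s ())) _
    injective (suc (suc _)) _ (s≤s (s≤s ())) _ _

  ι : ℕ → C
  ι n = n ⨯ 1#

  ι-+ : ∀ m n → ι (m + n) ≡ ι m +ᶠ ι n
  ι-+ m n = ×-homo-+ 1# m n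

  ι-* : ∀ m n → ι (m * n) ≡ ι m · ι n
  ι-* = ×1-homo-*

  ι-·-distrib : ∀ n a → ι n · a ≡ n ⨯ a
  ι-·-distrib zero a = zeroˡ a
  ι-·-distrib (suc n) a = trans (distribʳ a 1# (ι n)) (cong₂ _+ᶠ_ (*-identityˡ a) (ι-·-distrib n a))

  ι1≢0 : ι 1 ≢ 0#
  ι1≢0 ι1≡0 = 1≢0 (trans (sym (+-identityʳ 1#)) ι1≡0)

  ι-*≢0 : ∀ m n → ι m ≢ 0# → ι n ≢ 0# → ι (m * n) ≢ 0#
  ι-*≢0 m n ιm≢0 ιn≢0 ιmn≡0 = ιn≢0 (no-zero-divisors (ι m) (ι n) ιm≢0 (trans (sym (ι-* m n)) ιmn≡0))

  ι-equal⇒ι∸≡0 : ∀ {i j} → i ≤ j → ι j ≡ ι i → ι (j ∸ i) ≡ 0#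
  ι-equal⇒ι∸≡0 {i} {j} i≤j ιj≡ιi = +-cancelʳ (ι i) (ι (j ∸ i)) 0#
    (trans (sym (ι-+ (j ∸ i) i)) (trans (cong ι (ℕ.m∸n+n≡m i≤j)) (trans ιj≡ιi (sym (+-identityˡ (ι i))))))

  ι-injective : ∀ n → (∀ r → 1 ≤ r → r < n → ι r ≢ 0#) → InjectiveBelow ι n
  ι-injective n ιr≢0 i j i<n j<n ιi≡ιj with ℕ.<-cmp i j
  ... | tri≈ _ i≡j _ = i≡j
  ... | tri< i<j _ _ = ⊥-elim (ιr≢0 (j ∸ i) (ℕ.m<n⇒0<n∸m i<j) (ℕ.≤-<-trans (ℕ.m∸n≤m j i) j<n) (ι-equal⇒ι∸≡0 (ℕ.<⇒≤ i<j) (sym ιi≡ιj)))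
  ... | tri> _ _ j<i = ⊥-elim (ιr≢0 (i ∸ j) (ℕ.m<n⇒0<n∸m j<i) (ℕ.≤-<-trans (ℕ.m∸n≤m i j) i<n) (ι-equal⇒ι∸≡0 (ℕ.<⇒≤ j<i) ιi≡ιj))

  -- The values below m are closed under subtraction, as for an additive subgroup.
  ClosedBelow : (ℕ → C) → ℕ → Set
  ClosedBelow f m = ∀ i j → i < m → j < m → Σ ℕ λ k → (k < m) × (f i ≡ f k +ᶠ f j)

  ι-closed : ∀ p → ι p ≡ 0# → ClosedBelow ι p
  ι-closed p ιp≡0 i j i<p j<p with j ℕ.≤? i
  ... | yes j≤i = i ∸ j , ℕ.≤-<-trans (ℕ.m∸n≤m i j) i<p , trans (cong ι (sym (ℕ.m∸n+n≡m j≤i))) (ι-+ (i ∸ j) j)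
  ... | no j≰i = (i + p) ∸ j , k<p , sym (begin
      ι ((i + p) ∸ j) +ᶠ ι j   ≡⟨ sym (ι-+ ((i + p) ∸ j) j) ⟩
      ι ((i + p) ∸ j + j)      ≡⟨ cong ι (ℕ.m∸n+n≡m j≤i+p) ⟩
      ι (i + p)                ≡⟨ ι-+ i p ⟩
      ι i +ᶠ ι p               ≡⟨ cong (ι i +ᶠ_) ιp≡0 ⟩
      ι i +ᶠ 0#                ≡⟨ +-identityʳ _ ⟩
      ι i                      ∎)
    where
    open ≡-Reasoning
    j≤i+p : j ≤ i + p
    j≤i+p = ℕ.≤-trans (ℕ.<⇒≤ j<p) (ℕ.m≤n+m p i)
    k<p : (i + p) ∸ j < p
    k<p = ℕ.+-cancelʳ-< j ((i + p) ∸ j) p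
            (subst (_< p + j) (sym (ℕ.m∸n+n≡m j≤i+p)) (subst (i + p <_) (ℕ.+-comm j p) (ℕ.+-monoˡ-< p (ℕ.≰⇒> j≰i))))

  extend : (ℕ → C) → ℕ → C → ℕ → C
  extend f m b i with i <? m
  ... | yes _ = f i
  ... | no _ = b +ᶠ f (i ∸ m)

  extend-< : ∀ f m b i → i < m → extend f m b i ≡ f i
  extend-< f m b i i<m with i <? m
  ... | yes _ = refl
  ... | no i≮m = ⊥-elim (i≮m i<m)

  extend-+ : ∀ f m b k → extend f m b (m + k) ≡ b +ᶠ f k
  extend-+ f m b k with (m + k) <? m
  ... | yes m+k<m = ⊥-elim (ℕ.<⇒≱ m+k<m (ℕ.m≤m+n m k))
  ... | no _ = cong (λ z → b +ᶠ f z) (ℕ.m+n∸m≡n m k)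

  <m+m-split : ∀ m i → i < m + m → (i < m) ⊎ (Σ ℕ λ k → (k < m) × (i ≡ m + k))
  <m+m-split m i i<m+m with i <? m
  ... | yes i<m = inj₁ i<m
  ... | no i≮m = inj₂ (i ∸ m , ℕ.+-cancelˡ-< m (i ∸ m) m (subst (_< m + m) (sym m+[i∸m]≡i) i<m+m) , sym m+[i∸m]≡i)
    where m+[i∸m]≡i = ℕ.m+[n∸m]≡n (ℕ.≮⇒≥ i≮m)

  coset-disjoint : ∀ f m b → (∀ k → k < m → f k ≢ b) → ClosedBelow f m → ∀ i k → i < m → k < m → f i ≢ b +ᶠ f k
  coset-disjoint f m b b∉ closed i k' i<m k'<m fi≡b+fk' with closed i k' i<m k'<m
  ... | k , k<m , fi≡fk+fk' = b∉ k k<m (sym (+-cancelʳ (f k') b (f k) (trans (sym fi≡b+fk') fi≡fk+fk')))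

  extend-injective : ∀ f m b → InjectiveBelow f m → (∀ k → k < m → f k ≢ b) → ClosedBelow f m → InjectiveBelow (extend f m b) (m + m)
  extend-injective f m b injective b∉ closed i j i<2m j<2m e with <m+m-split m i i<2m | <m+m-split m j j<2m
  ... | inj₁ i<m | inj₁ j<m = injective i j i<m j<m (trans (sym (extend-< f m b i i<m)) (trans e (extend-< f m b j j<m)))
  ... | inj₂ (k , k<m , refl) | inj₂ (k' , k'<m , refl) =
        cong (m +_) (injective k k' k<m k'<m (+-cancelˡ b (f k) (f k') (trans (sym (extend-+ f m b k)) (trans e (extend-+ f m b k')))))
  ... | inj₁ i<m | inj₂ (k' , k'<m , refl) =
        ⊥-elim (coset-disjoint f m b b∉ closed i k' i<m k'<m (trans (sym (extend-< f m b i i<m)) (trans e (extend-+ f m b k'))))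
  ... | inj₂ (k , k<m , refl) | inj₁ j<m =
        ⊥-elim (coset-disjoint f m b b∉ closed j k j<m k<m (trans (sym (extend-< f m b j j<m)) (trans (sym e) (extend-+ f m b k))))

  extend-closed : ∀ f m b → b +ᶠ b ≡ 0# → ClosedBelow f m → ClosedBelow (extend f m b) (m + m)
  extend-closed f m b b+b≡0 closed i j i<2m j<2m with <m+m-split m i i<2m | <m+m-split m j j<2m
  ... | inj₁ i<m | inj₁ j<m with closed i j i<m j<m
  ...   | k , k<m , fi≡ = k , ℕ.≤-trans k<m (ℕ.m≤m+n m m) ,
          trans (extend-< f m b i i<m) (trans fi≡ (sym (cong₂ _+ᶠ_ (extend-< f m b k k<m) (extend-< f m b j j<m))))
  extend-closed f m b b+b≡0 closed i j i<2m j<2m | inj₂ (k₁ , k₁<m , refl) | inj₂ (k₂ , k₂<m , refl) with closed k₁ k₂ k₁<m k₂<m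
  ...   | k , k<m , fk₁≡ = k , ℕ.≤-trans k<m (ℕ.m≤m+n m m) ,
          trans (extend-+ f m b k₁) (trans (cong (b +ᶠ_) fk₁≡) (trans (+-swapˡ b (f k) (f k₂))
            (sym (cong₂ _+ᶠ_ (extend-< f m b k k<m) (extend-+ f m b k₂)))))
  extend-closed f m b b+b≡0 closed i j i<2m j<2m | inj₂ (k₁ , k₁<m , refl) | inj₁ j<m with closed k₁ j k₁<m j<m
  ...   | k , k<m , fk₁≡ = m + k , ℕ.+-monoʳ-< m k<m ,
          trans (extend-+ f m b k₁) (trans (cong (b +ᶠ_) fk₁≡) (trans (sym (+-assoc b (f k) (f j)))
            (sym (cong₂ _+ᶠ_ (extend-+ f m b k) (extend-< f m b j j<m)))))
  extend-closed f m b b+b≡0 closed i j i<2m j<2m | inj₁ i<m | inj₂ (k₂ , k₂<m , refl) with closed i k₂ i<m k₂<m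
  ...   | k , k<m , fi≡ = m + k , ℕ.+-monoʳ-< m k<m ,
          trans (extend-< f m b i i<m) (trans fi≡ (trans (sym (cancel-b (f k) (f k₂)))
            (sym (cong₂ _+ᶠ_ (extend-+ f m b k) (extend-+ f m b k₂)))))
    where
    cancel-b : ∀ x y → (b +ᶠ x) +ᶠ (b +ᶠ y) ≡ x +ᶠ y
    cancel-b x y = trans (+-interchange b x b y) (trans (cong (_+ᶠ (x +ᶠ y)) b+b≡0) (+-identityˡ _))

  adjoin : (ℕ → C) → ℕ → C → ℕ → C
  adjoin f m b i with i <? m
  ... | yes _ = f i
  ... | no _ = b

  adjoin-injective : ∀ f m b → InjectiveBelow f m → (∀ k → k < m → f k ≢ b) → InjectiveBelow (adjoin f m b) (suc m)
  adjoin-injective f m b injective b∉ i j i<1+m j<1+m e with i <? m | j <? m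
  ... | yes i<m | yes j<m = injective i j i<m j<m e
  ... | no i≮m | no j≮m = trans (ℕ.≤-antisym (ℕ.≤-pred i<1+m) (ℕ.≮⇒≥ i≮m)) (sym (ℕ.≤-antisym (ℕ.≤-pred j<1+m) (ℕ.≮⇒≥ j≮m)))
  ... | yes i<m | no _ = ⊥-elim (b∉ i i<m e)
  ... | no _ | yes j<m = ⊥-elim (b∉ j j<m (sym e))

  ⨯-characteristic : ∀ n a → ι n ≡ 0# → n ⨯ a ≡ 0#
  ⨯-characteristic n a ιn≡0 = trans (sym (ι-·-distrib n a)) (trans (cong (_· a) ιn≡0) (zeroˡ a))

  -- In characteristic 2, {0, 1} grows into an additive subgroup of order 4 and then into 8 distinct elements.
  characteristic-2 : ι 2 ≡ 0# → 4 < size → 8 ≤ size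
  characteristic-2 ι2≡0 4<size = injective⇒≤size (extend f₁ 4 b) 8 (extend-injective f₁ 4 b injective₁ (proj₂ b,b∉) closed₁)
    where
    injective₀ : InjectiveBelow ι 2
    injective₀ = ι-injective 2 λ { 1 _ _ → ι1≢0 ; (suc (suc _)) _ (s≤s (s≤s ())) }
    closed₀ : ClosedBelow ι 2
    closed₀ = ι-closed 2 ι2≡0
    a,a∉ : Σ C λ a → ∀ k → k < 2 → ι k ≢ a
    a,a∉ = outside-image ι 2 (ℕ.<-trans (ℕ.m<m+n 2 (s≤s z≤n)) 4<size)
    a : C
    a = proj₁ a,a∉
    a+a≡0 : a +ᶠ a ≡ 0#
    a+a≡0 = trans (cong (a +ᶠ_) (sym (+-identityʳ a))) (⨯-characteristic 2 a ι2≡0)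
    f₁ : ℕ → C
    f₁ = extend ι 2 a
    injective₁ : InjectiveBelow f₁ 4
    injective₁ = extend-injective ι 2 a injective₀ (proj₂ a,a∉) closed₀
    closed₁ : ClosedBelow f₁ 4
    closed₁ = extend-closed ι 2 a a+a≡0 closed₀
    b,b∉ : Σ C λ b → ∀ k → k < 4 → f₁ k ≢ b
    b,b∉ = outside-image f₁ 4 4<size
    b : C
    b = proj₁ b,b∉

  -- In characteristic 3, {0, 1, 2} and its coset a + {0, 1, 2} miss 2a.
  characteristic-3 : ι 2 ≢ 0# → ι 3 ≡ 0# → 3 < size → 7 ≤ size
  characteristic-3 ι2≢0 ι3≡0 3<size = injective⇒≤size (adjoin f₁ 6 (a +ᶠ a)) 7 (adjoin-injective f₁ 6 (a +ᶠ a) injective₁ 2a∉)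
    where
    injective₀ : InjectiveBelow ι 3
    injective₀ = ι-injective 3 λ { 1 _ _ → ι1≢0 ; 2 _ _ → ι2≢0 ; (suc (suc (suc _))) _ (s≤s (s≤s (s≤s ()))) }
    closed₀ : ClosedBelow ι 3
    closed₀ = ι-closed 3 ι3≡0
    a,a∉ : Σ C λ a → ∀ k → k < 3 → ι k ≢ a
    a,a∉ = outside-image ι 3 3<size
    a : C
    a = proj₁ a,a∉
    a∉ : ∀ k → k < 3 → ι k ≢ a
    a∉ = proj₂ a,a∉
    3a≡0 : (a +ᶠ a) +ᶠ a ≡ 0#
    3a≡0 = trans (+-assoc a a a) (trans (cong (λ z → a +ᶠ (a +ᶠ z)) (sym (+-identityʳ a))) (⨯-characteristic 3 a ι3≡0))
    f₁ : ℕ → C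
    f₁ = extend ι 3 a
    injective₁ : InjectiveBelow f₁ 6
    injective₁ = extend-injective ι 3 a injective₀ a∉ closed₀
    2a∉ : ∀ k → k < 6 → f₁ k ≢ a +ᶠ a
    2a∉ k k<6 f₁k≡2a with <m+m-split 3 k k<6
    ... | inj₁ k<3 with closed₀ 0 k (s≤s z≤n) k<3
    ...   | k' , k'<3 , 0≡ιk'+ιk = a∉ k' k'<3 (sym (+-cancelʳ (ι k) a (ι k')
            (trans (+-comm a (ι k)) (trans (cong (_+ᶠ a) (trans (sym (extend-< ι 3 a k k<3)) f₁k≡2a)) (trans 3a≡0 0≡ιk'+ιk)))))
    2a∉ k k<6 f₁k≡2a | inj₂ (k' , k'<3 , refl) = a∉ k' k'<3 (+-cancelˡ a (ι k') a (trans (sym (extend-+ ι 3 a k')) f₁k≡2a))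

  characteristic-5 : ι 2 ≢ 0# → ι 3 ≢ 0# → ι 5 ≡ 0# → 5 < size → 10 ≤ size
  characteristic-5 ι2≢0 ι3≢0 ι5≡0 5<size =
    injective⇒≤size (extend ι 5 a) 10 (extend-injective ι 5 a injective₀ (proj₂ a,a∉) (ι-closed 5 ι5≡0))
    where
    injective₀ : InjectiveBelow ι 5
    injective₀ = ι-injective 5 λ { 1 _ _ → ι1≢0 ; 2 _ _ → ι2≢0 ; 3 _ _ → ι3≢0 ; 4 _ _ → ι-*≢0 2 2 ι2≢0 ι2≢0
                                 ; (suc (suc (suc (suc (suc _))))) _ (s≤s (s≤s (s≤s (s≤s (s≤s ()))))) }
    a,a∉ : Σ C λ a → ∀ k → k < 5 → ι k ≢ a
    a,a∉ = outside-image ι 5 5<size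
    a : C
    a = proj₁ a,a∉

  characteristic-≥7 : ι 2 ≢ 0# → ι 3 ≢ 0# → ι 5 ≢ 0# → 7 ≤ size
  characteristic-≥7 ι2≢0 ι3≢0 ι5≢0 = injective⇒≤size ι 7 (ι-injective 7 λ
    { 1 _ _ → ι1≢0 ; 2 _ _ → ι2≢0 ; 3 _ _ → ι3≢0 ; 4 _ _ → ι-*≢0 2 2 ι2≢0 ι2≢0 ; 5 _ _ → ι5≢0 ; 6 _ _ → ι-*≢0 2 3 ι2≢0 ι3≢0
    ; (suc (suc (suc (suc (suc (suc (suc _))))))) _ (s≤s (s≤s (s≤s (s≤s (s≤s (s≤s (s≤s ()))))))) })

  -- No field has six elements: its characteristic would be 2, 3, 5 or at least 7, and each case yields seven distinct elements.
  5<size⇒7≤size : 5 < size → 7 ≤ size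
  5<size⇒7≤size 5<size with ι 2 ≟C 0# | ι 3 ≟C 0# | ι 5 ≟C 0#
  ... | yes ι2≡0 | _ | _ = ℕ.≤-trans (ℕ.n≤1+n 7) (characteristic-2 ι2≡0 (ℕ.<-trans (ℕ.n<1+n 4) 5<size))
  ... | no ι2≢0 | yes ι3≡0 | _ = characteristic-3 ι2≢0 ι3≡0 (ℕ.<-trans (ℕ.m<m+n 3 (s≤s z≤n)) 5<size)
  ... | no ι2≢0 | no ι3≢0 | yes ι5≡0 = ℕ.≤-trans (ℕ.m≤m+n 7 3) (characteristic-5 ι2≢0 ι3≢0 ι5≡0 5<size)
  ... | no ι2≢0 | no ι3≢0 | no ι5≢0 = characteristic-≥7 ι2≢0 ι3≢0 ι5≢0

-- Estimates

2*⌊n/2⌋≤n : ∀ n → 2 * ⌊ n /2⌋ ≤ n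
2*⌊n/2⌋≤n zero = z≤n
2*⌊n/2⌋≤n (suc zero) = z≤n
2*⌊n/2⌋≤n (suc (suc n)) = subst (_≤ 2 + n) (sym (two-suc ⌊ n /2⌋)) (s≤s (s≤s (2*⌊n/2⌋≤n n)))
  where
  two-suc : ∀ h → 2 * suc h ≡ 2 + 2 * h
  two-suc = solve-∀

n≤1+2*⌊n/2⌋ : ∀ n → n ≤ suc (2 * ⌊ n /2⌋)
n≤1+2*⌊n/2⌋ zero = z≤n
n≤1+2*⌊n/2⌋ (suc zero) = s≤s z≤n
n≤1+2*⌊n/2⌋ (suc (suc n)) = subst (2 + n ≤_) (cong suc (sym (two-suc ⌊ n /2⌋))) (s≤s (s≤s (n≤1+2*⌊n/2⌋ n)))
  where
  two-suc : ∀ h → 2 * suc h ≡ 2 + 2 * h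
  two-suc = solve-∀

n≤2*⌈n/2⌉ : ∀ n → n ≤ 2 * ⌈ n /2⌉
n≤2*⌈n/2⌉ n = ℕ.≤-pred (n≤1+2*⌊n/2⌋ (suc n))

third : ∀ n → Σ ℕ λ g → (3 * g ≤ n) × (n < 3 * g + 3)
third zero = 0 , z≤n , s≤s z≤n
third (suc zero) = 0 , z≤n , s≤s (s≤s z≤n)
third (suc (suc zero)) = 0 , z≤n , s≤s (s≤s (s≤s z≤n))
third (suc (suc (suc n))) with third n
... | g , 3g≤n , n<3g+3 = suc g , subst (_≤ 3 + n) (sym (three-suc g)) (ℕ.+-monoʳ-≤ 3 3g≤n)
                                , subst (3 + n <_) (sym (three-suc-+3 g)) (ℕ.+-monoʳ-< 3 n<3g+3)
  where
  three-suc : ∀ g → 3 * suc g ≡ 3 + 3 * g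
  three-suc = solve-∀
  three-suc-+3 : ∀ g → 3 * suc g + 3 ≡ 3 + (3 * g + 3)
  three-suc-+3 = solve-∀

2*≤1+2*⇒≤ : ∀ d h → 2 * d ≤ suc (2 * h) → d ≤ h
2*≤1+2*⇒≤ d h le with d ≤? h
... | yes d≤h = d≤h
... | no d≰h = ⊥-elim (ℕ.<⇒≱ (subst (_≤ 2 * d) (two-suc h) (ℕ.*-monoʳ-≤ 2 (ℕ.≰⇒> d≰h))) le)
  where
  two-suc : ∀ h → 2 * suc h ≡ suc (suc (2 * h))
  two-suc = solve-∀

≤⌊n/2⌋ : ∀ {d n} → 2 * d ≤ n → d ≤ ⌊ n /2⌋
≤⌊n/2⌋ {d} {n} 2d≤n = 2*≤1+2*⇒≤ d ⌊ n /2⌋ (ℕ.≤-trans 2d≤n (n≤1+2*⌊n/2⌋ n))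

half<n : ∀ {h n} → 1 ≤ n → 2 * h ≤ n → h < n
half<n {zero} 1≤n _ = 1≤n
half<n {suc h} {n} _ 2h≤n = ℕ.<-≤-trans (ℕ.m<m+n (suc h) (s≤s z≤n)) (subst (_≤ n) (cong (suc h +_) (ℕ.+-identityʳ (suc h))) 2h≤n)

properDivisor-half-or-third : ∀ n d → (1 ≤ d) × (d Div.∣ n) → d < n → (2 * d ≡ n) ⊎ (3 * d ≤ n)
properDivisor-half-or-third n d (1≤d , Div.divides k n≡kd) d<n with k
... | zero = ⊥-elim (ℕ.<⇒≱ (ℕ.≤-trans 1≤d (ℕ.<⇒≤ d<n)) (ℕ.≤-reflexive n≡kd))
... | suc zero = ⊥-elim (ℕ.<-irrefl (sym (trans n≡kd (ℕ.+-identityʳ d))) d<n)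
... | suc (suc zero) = inj₁ (sym n≡kd)
... | suc (suc (suc k)) = inj₂ (subst (3 * d ≤_) (sym n≡kd) (ℕ.*-monoˡ-≤ d {3} {3 + k} (ℕ.m≤m+n 3 k)))

properDivisor≤⌊n/2⌋ : ∀ n d → (1 ≤ d) × (d Div.∣ n) → d < n → d ≤ ⌊ n /2⌋
properDivisor≤⌊n/2⌋ n d pd d<n with properDivisor-half-or-third n d pd d<n
... | inj₁ 2d≡n = ≤⌊n/2⌋ (ℕ.≤-reflexive 2d≡n)
... | inj₂ 3d≤n = ≤⌊n/2⌋ (ℕ.≤-trans (ℕ.*-monoˡ-≤ d {2} {3} (ℕ.n≤1+n 2)) 3d≤n)

-- Induction on u: the hypothesis a ≤ c q² lets c q^u absorb each increment a.
linear<exponential : ∀ a b c q u → 2 ≤ q → 2 ≤ u → a ≤ c * q ^ 2 → a * 2 + b < c * q ^ 2 → a * u + b < c * q ^ u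
linear<exponential a b c q (suc zero) _ (s≤s ()) _ _
linear<exponential a b c q (suc (suc u)) 2≤q _ a≤ base = go u
  where
  q≢0 : NonZero q
  q≢0 = >-nonZero (ℕ.≤-trans (s≤s z≤n) 2≤q)
  shift : ∀ a u b → a * (3 + u) + b ≡ (a * (2 + u) + b) + a
  shift = solve-∀
  double : ∀ x → x + x ≡ 2 * x
  double = solve-∀
  swap : ∀ q c x → q * (c * x) ≡ c * (q * x)
  swap = solve-∀
  go : ∀ u → a * (2 + u) + b < c * q ^ (2 + u)
  go zero = base
  go (suc u) = begin-strict
    a * (3 + u) + b                    ≡⟨ shift a u b ⟩
    (a * (2 + u) + b) + a              <⟨ ℕ.+-monoˡ-< a (go u) ⟩
    c * q ^ (2 + u) + a                ≤⟨ ℕ.+-monoʳ-≤ (c * q ^ (2 + u)) (ℕ.≤-trans a≤ (ℕ.*-monoʳ-≤ c (ℕ.^-monoʳ-≤ q {{q≢0}} (ℕ.m≤m+n 2 u)))) ⟩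
    c * q ^ (2 + u) + c * q ^ (2 + u)  ≡⟨ double (c * q ^ (2 + u)) ⟩
    2 * (c * q ^ (2 + u))              ≤⟨ ℕ.*-monoˡ-≤ (c * q ^ (2 + u)) 2≤q ⟩
    q * (c * q ^ (2 + u))              ≡⟨ swap q c (q ^ (2 + u)) ⟩
    c * q ^ (3 + u)                    ∎
    where open ℕ.≤-Reasoning

6x+3≤5*2^x : ∀ x → 6 * x + 3 ≤ 5 * 2 ^ x
6x+3≤5*2^x zero = ℕ.m≤m+n 3 2
6x+3≤5*2^x (suc zero) = ℕ.n≤1+n 9
6x+3≤5*2^x x@(suc (suc _)) = ℕ.<⇒≤ (linear<exponential 6 3 5 2 x ℕ.≤-refl (s≤s (s≤s z≤n)) (ℕ.m≤m+n 6 14) (ℕ.m≤m+n 16 4))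

square≤ : ∀ x C q n → .{{NonZero q}} → x ≤ C * q ^ ⌊ n /2⌋ → x ^ 2 ≤ C ^ 2 * q ^ n
square≤ x C q n x≤ = begin
  x ^ 2                    ≤⟨ ℕ.^-monoˡ-≤ 2 x≤ ⟩
  (C * q ^ h) ^ 2          ≡⟨ square-* C (q ^ h) ⟩
  C ^ 2 * (q ^ h * q ^ h)  ≡⟨ cong (C ^ 2 *_) (sym (ℕ.^-distribˡ-+-* q h h)) ⟩
  C ^ 2 * q ^ (h + h)      ≤⟨ ℕ.*-monoʳ-≤ (C ^ 2) (ℕ.^-monoʳ-≤ q (subst (_≤ n) (cong (h +_) (ℕ.+-identityʳ h)) (2*⌊n/2⌋≤n n))) ⟩
  C ^ 2 * q ^ n            ∎
  where
  open ℕ.≤-Reasoning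
  h : ℕ
  h = ⌊ n /2⌋
  square-* : ∀ c y → (c * y) * ((c * y) * 1) ≡ (c * (c * 1)) * (y * y)
  square-* = solve-∀

-- The case n = 2 of the inequalities, where E_2 = (q^2 - q) / 2 and A_2 = q.
2q+4<E₂ : ∀ q e → 7 ≤ q → 2 * e + q ≡ q * q → 2 * q + 4 < e
2q+4<E₂ q e 7≤q 2e+q≡q² = ℕ.*-cancelˡ-< 2 (2 * q + 4) e (ℕ.+-cancelʳ-< q (2 * (2 * q + 4)) (2 * e) (begin-strict
  2 * (2 * q + 4) + q      ≡⟨ expand q ⟩
  5 * q + 8                <⟨ ℕ.+-monoʳ-< (5 * q) (ℕ.≤-trans (ℕ.m≤m+n 9 5) (ℕ.*-monoʳ-≤ 2 7≤q)) ⟩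
  5 * q + 2 * q            ≡⟨ collect q ⟩
  7 * q                    ≤⟨ ℕ.*-monoˡ-≤ q 7≤q ⟩
  q * q                    ≡⟨ sym 2e+q≡q² ⟩
  2 * e + q                ∎))
  where
  open ℕ.≤-Reasoning
  expand : ∀ q → 2 * (2 * q + 4) + q ≡ 5 * q + 8
  expand = solve-∀
  collect : ∀ q → 5 * q + 2 * q ≡ 7 * q
  collect = solve-∀

100[4q+q+2]+2[q+e]<100e : ∀ q e → 12 ≤ q → 2 * e + q ≡ q * q → 100 * (4 * q + q + 2) + 2 * (q + e) < 100 * e
100[4q+q+2]+2[q+e]<100e q e 12≤q 2e+q≡q² = ℕ.*-cancelˡ-< 2 _ _ (ℕ.+-cancelʳ-< (98 * q) _ _ (begin-strict
  2 * (100 * (4 * q + q + 2) + 2 * (q + e)) + 98 * q  ≡⟨ expand q e ⟩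
  1102 * q + 400 + 2 * (2 * e)                       <⟨ ℕ.+-monoˡ-< (2 * (2 * e)) (ℕ.+-monoʳ-< (1102 * q) (ℕ.≤-trans (ℕ.m≤m+n 401 487) (ℕ.*-monoʳ-≤ 74 12≤q))) ⟩
  1102 * q + 74 * q + 2 * (2 * e)                    ≡⟨ cong (_+ 2 * (2 * e)) (collect q) ⟩
  98 * (12 * q) + 2 * (2 * e)                        ≤⟨ ℕ.+-monoˡ-≤ (2 * (2 * e)) (ℕ.*-monoʳ-≤ 98 (ℕ.*-monoˡ-≤ q 12≤q)) ⟩
  98 * (q * q) + 2 * (2 * e)                         ≡⟨ cong (λ z → 98 * z + 2 * (2 * e)) (sym 2e+q≡q²) ⟩
  98 * (2 * e + q) + 2 * (2 * e)                     ≡⟨ regroup q e ⟩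
  2 * (100 * e) + 98 * q                             ∎))
  where
  open ℕ.≤-Reasoning
  expand : ∀ q e → 2 * (100 * (4 * q + q + 2) + 2 * (q + e)) + 98 * q ≡ 1102 * q + 400 + 2 * (2 * e)
  expand = solve-∀
  collect : ∀ q → 1102 * q + 74 * q ≡ 98 * (12 * q)
  collect = solve-∀
  regroup : ∀ q e → 98 * (2 * e + q) + 2 * (2 * e) ≡ 2 * (100 * e) + 98 * q
  regroup = solve-∀

-- Aₑ and nBₑ are A and nB of Defs for an arbitrary sequence E: the estimates only use Σ_{d ∣ m} d E_d = q^m.
module Bounds (q : ℕ) (2≤q : 2 ≤ q) (E : ℕ → ℕ) where

  Aₑ nBₑ : ℕ → ℕ
  Aₑ n = sum (map E (properDivisors n))
  nBₑ n = sum (map (λ d → d * E d) (properDivisors n))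

  private instance
    q≢0 : NonZero q
    q≢0 = >-nonZero (ℕ.≤-trans (s≤s z≤n) 2≤q)

  ∑-geometric : ∀ h → ∑ (range (suc h)) (q ^_) ≤ 2 * q ^ h
  ∑-geometric zero = s≤s z≤n
  ∑-geometric (suc h) = begin
    ∑ (range (suc (suc h))) (q ^_)        ≡⟨ ∑-range-last (suc h) (q ^_) ⟩
    ∑ (range (suc h)) (q ^_) + q ^ suc h  ≤⟨ ℕ.+-monoˡ-≤ (q ^ suc h) (∑-geometric h) ⟩
    2 * q ^ h + q ^ suc h                 ≤⟨ ℕ.+-monoˡ-≤ (q ^ suc h) (ℕ.*-monoˡ-≤ (q ^ h) 2≤q) ⟩
    q ^ suc h + q ^ suc h                 ≡⟨ double (q ^ suc h) ⟩
    2 * q ^ suc h                         ∎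
    where
    open ℕ.≤-Reasoning
    double : ∀ x → x + x ≡ 2 * x
    double = solve-∀

  q^⌈n/2⌉*q^⌊n/2⌋≡q^n : ∀ n → q ^ ⌈ n /2⌉ * q ^ ⌊ n /2⌋ ≡ q ^ n
  q^⌈n/2⌉*q^⌊n/2⌋≡q^n n =
    trans (sym (ℕ.^-distribˡ-+-* q ⌈ n /2⌉ ⌊ n /2⌋)) (cong (q ^_) (trans (ℕ.+-comm ⌈ n /2⌉ ⌊ n /2⌋) (ℕ.⌊n/2⌋+⌈n/2⌉≡n n)))

  -- With x = ⌊n/2⌋ - g: n ≤ 6 x + 3 ≤ 5 · 2^x.
  n*q^g≤q^⌊n/2⌋ : ∀ n g → 3 * g ≤ n → n * (2 * q ^ g) ≤ 10 * q ^ ⌊ n /2⌋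
  n*q^g≤q^⌊n/2⌋ n g 3g≤n = begin
    n * (2 * q ^ g)                ≤⟨ ℕ.*-monoˡ-≤ (2 * q ^ g) (ℕ.≤-trans n≤6x+3 (ℕ.≤-trans (6x+3≤5*2^x x) (ℕ.*-monoʳ-≤ 5 (ℕ.^-monoˡ-≤ x 2≤q)))) ⟩
    (5 * q ^ x) * (2 * q ^ g)      ≡⟨ rearrange (q ^ x) (q ^ g) ⟩
    10 * (q ^ g * q ^ x)           ≡⟨ cong (10 *_) (trans (sym (ℕ.^-distribˡ-+-* q g x)) (cong (q ^_) (sym h≡g+x))) ⟩
    10 * q ^ h                     ∎
    where
    open ℕ.≤-Reasoning
    h x : ℕ
    h = ⌊ n /2⌋
    x = h ∸ g
    h≡g+x : h ≡ g + x
    h≡g+x = sym (ℕ.m+[n∸m]≡n (≤⌊n/2⌋ {g} (ℕ.≤-trans (ℕ.*-monoˡ-≤ g {2} {3} (ℕ.n≤1+n 2)) 3g≤n)))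
    n≤6x+3 : n ≤ 6 * x + 3
    n≤6x+3 = ℕ.+-cancelʳ-≤ (2 * n) n (6 * x + 3) (begin
      n + 2 * n                      ≡⟨ triple n ⟩
      3 * n                          ≤⟨ ℕ.*-monoʳ-≤ 3 (n≤1+2*⌊n/2⌋ n) ⟩
      3 * suc (2 * h)                ≡⟨ cong (λ z → 3 * suc (2 * z)) h≡g+x ⟩
      3 * suc (2 * (g + x))          ≡⟨ expand g x ⟩
      (6 * x + 3) + 2 * (3 * g)      ≤⟨ ℕ.+-monoʳ-≤ (6 * x + 3) (ℕ.*-monoʳ-≤ 2 3g≤n) ⟩
      (6 * x + 3) + 2 * n            ∎)
      where
      triple : ∀ n → n + 2 * n ≡ 3 * n
      triple = solve-∀
      expand : ∀ g x → 3 * suc (2 * (g + x)) ≡ (6 * x + 3) + 2 * (3 * g)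
      expand = solve-∀
    rearrange : ∀ a b → (5 * a) * (2 * b) ≡ 10 * (b * a)
    rearrange = solve-∀

  module _ (divisorSum : ∀ m → 1 ≤ m → nBₑ m + m * E m ≡ q ^ m) where

    dE≤q^d : ∀ d → 1 ≤ d → d * E d ≤ q ^ d
    dE≤q^d d 1≤d = subst (d * E d ≤_) (divisorSum d 1≤d) (ℕ.m≤n+m _ _)

    E≤q^d : ∀ d → 1 ≤ d → E d ≤ q ^ d
    E≤q^d d@(suc _) 1≤d = ℕ.≤-trans (ℕ.m≤m+n (E d) _) (dE≤q^d d 1≤d)

    nB≤ : ∀ n → 1 ≤ n → nBₑ n ≤ 2 * q ^ ⌊ n /2⌋
    nB≤ n 1≤n = begin
      nBₑ n                                                   ≡⟨ sum-properDivisors n (λ d → d * E d) ⟩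
      ∑ (range n) (λ d → 𝟙 (properDivisor? n d) * (d * E d))  ≤⟨ ∑-range-mono n below-half ⟩
      ∑ (range n) (λ d → 𝟙 (d ≤? h) * q ^ d)                  ≡⟨ ∑-range-𝟙≤ n h (q ^_) (half<n 1≤n (2*⌊n/2⌋≤n n)) ⟩
      ∑ (range (suc h)) (q ^_)                                ≤⟨ ∑-geometric h ⟩
      2 * q ^ h                                               ∎
      where
      open ℕ.≤-Reasoning
      h : ℕ
      h = ⌊ n /2⌋
      below-half : ∀ d → d < n → 𝟙 (properDivisor? n d) * (d * E d) ≤ 𝟙 (d ≤? h) * q ^ d
      below-half d d<n with properDivisor? n d
      ... | no _ = z≤n
      ... | yes pd@(1≤d , _) = subst (d * E d + 0 ≤_) (cong (_* q ^ d) (sym (𝟙-yes (d ≤? h) (properDivisor≤⌊n/2⌋ n d pd d<n))))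
                                 (ℕ.+-monoˡ-≤ 0 (dE≤q^d d 1≤d))

    A≤nB : ∀ n → Aₑ n ≤ nBₑ n
    A≤nB n = subst₂ _≤_ (sym (sum-properDivisors n E)) (sym (sum-properDivisors n (λ d → d * E d))) (∑-range-mono n termwise)
      where
      termwise : ∀ d → d < n → 𝟙 (properDivisor? n d) * E d ≤ 𝟙 (properDivisor? n d) * (d * E d)
      termwise d _ with properDivisor? n d
      ... | yes (1≤d , _) = ℕ.+-monoˡ-≤ 0 (ℕ.m≤n*m (E d) d {{>-nonZero 1≤d}})
      ... | no _ = z≤n

    -- Only d = n / 2 contributes at the scale q^(n/2); all other proper divisors are at most n / 3.
    n*A≤ : ∀ n → 1 ≤ n → n * Aₑ n ≤ 12 * q ^ ⌊ n /2⌋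
    n*A≤ n 1≤n = begin
      n * Aₑ n
        ≡⟨ cong (n *_) (sum-properDivisors n E) ⟩
      n * ∑ (range n) (λ d → 𝟙 (properDivisor? n d) * E d)
        ≡⟨ sym (∑-*ˡ (range n) n _) ⟩
      ∑ (range n) (λ d → n * (𝟙 (properDivisor? n d) * E d))
        ≤⟨ ∑-range-mono n termwise ⟩
      ∑ (range n) (λ d → 𝟙 (d ℕ.≟ h) * (2 * q ^ h) + 𝟙 (d ≤? g) * (n * q ^ d))
        ≡⟨ ∑-distrib-+ (range n) (λ d → 𝟙 (d ℕ.≟ h) * (2 * q ^ h)) (λ d → 𝟙 (d ≤? g) * (n * q ^ d)) ⟩
      ∑ (range n) (λ d → 𝟙 (d ℕ.≟ h) * (2 * q ^ h)) + ∑ (range n) (λ d → 𝟙 (d ≤? g) * (n * q ^ d))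
        ≡⟨ cong₂ _+_ (∑-range-delta n h (λ _ → 2 * q ^ h) (half<n 1≤n 2h≤n))
                     (trans (∑-range-𝟙≤ n g (λ d → n * q ^ d) g<n) (∑-*ˡ (range (suc g)) n (q ^_))) ⟩
      2 * q ^ h + n * ∑ (range (suc g)) (q ^_)
        ≤⟨ ℕ.+-monoʳ-≤ (2 * q ^ h) (ℕ.*-monoʳ-≤ n (∑-geometric g)) ⟩
      2 * q ^ h + n * (2 * q ^ g)
        ≤⟨ ℕ.+-monoʳ-≤ (2 * q ^ h) (n*q^g≤q^⌊n/2⌋ n g 3g≤n) ⟩
      2 * q ^ h + 10 * q ^ h
        ≡⟨ sym (ℕ.*-distribʳ-+ (q ^ h) 2 10) ⟩
      12 * q ^ h ∎
      where
      open ℕ.≤-Reasoning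
      h g : ℕ
      h = ⌊ n /2⌋
      g = proj₁ (third n)
      2h≤n : 2 * h ≤ n
      2h≤n = 2*⌊n/2⌋≤n n
      3g≤n : 3 * g ≤ n
      3g≤n = proj₁ (proj₂ (third n))
      n<3g+3 : n < 3 * g + 3
      n<3g+3 = proj₂ (proj₂ (third n))
      g<n : g < n
      g<n = half<n 1≤n (ℕ.≤-trans (ℕ.*-monoˡ-≤ g {2} {3} (ℕ.n≤1+n 2)) 3g≤n)
      termwise : ∀ d → d < n → n * (𝟙 (properDivisor? n d) * E d) ≤ 𝟙 (d ℕ.≟ h) * (2 * q ^ h) + 𝟙 (d ≤? g) * (n * q ^ d)
      termwise d d<n with properDivisor? n d
      ... | no _ = ℕ.≤-trans (ℕ.≤-reflexive (ℕ.*-zeroʳ n)) z≤n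
      ... | yes pd@(1≤d , _) with properDivisor-half-or-third n d pd d<n
      ...   | inj₁ 2d≡n = ℕ.≤-trans half-term (ℕ.m≤m+n _ _)
        where
        d≡h : d ≡ h
        d≡h = ℕ.≤-antisym (≤⌊n/2⌋ (ℕ.≤-reflexive 2d≡n)) (ℕ.*-cancelˡ-≤ 2 (subst (2 * h ≤_) (sym 2d≡n) 2h≤n))
        half-term : n * (1 * E d) ≤ 𝟙 (d ℕ.≟ h) * (2 * q ^ h)
        half-term = begin
          n * (1 * E d)                ≡⟨ cong (n *_) (ℕ.*-identityˡ _) ⟩
          n * E d                      ≡⟨ cong (_* E d) (sym 2d≡n) ⟩
          (2 * d) * E d                ≡⟨ ℕ.*-assoc 2 d (E d) ⟩
          2 * (d * E d)                ≤⟨ ℕ.*-monoʳ-≤ 2 (dE≤q^d d 1≤d) ⟩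
          2 * q ^ d                    ≡⟨ cong (λ z → 2 * q ^ z) d≡h ⟩
          2 * q ^ h                    ≡⟨ sym (ℕ.*-identityˡ _) ⟩
          1 * (2 * q ^ h)              ≡⟨ cong (_* (2 * q ^ h)) (sym (𝟙-yes (d ℕ.≟ h) d≡h)) ⟩
          𝟙 (d ℕ.≟ h) * (2 * q ^ h)    ∎
      ...   | inj₂ 3d≤n = ℕ.≤-trans third-term (ℕ.m≤n+m _ _)
        where
        d≤g : d ≤ g
        d≤g = ℕ.≤-pred (ℕ.*-cancelˡ-< 3 d (suc g) (subst (3 * d <_) (three-suc g) (ℕ.≤-<-trans 3d≤n n<3g+3)))
          where
          three-suc : ∀ g → 3 * g + 3 ≡ 3 * suc g
          three-suc = solve-∀
        third-term : n * (1 * E d) ≤ 𝟙 (d ≤? g) * (n * q ^ d)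
        third-term = begin
          n * (1 * E d)                ≡⟨ cong (n *_) (ℕ.*-identityˡ _) ⟩
          n * E d                      ≤⟨ ℕ.*-monoʳ-≤ n (E≤q^d d 1≤d) ⟩
          n * q ^ d                    ≡⟨ sym (ℕ.*-identityˡ _) ⟩
          1 * (n * q ^ d)              ≡⟨ cong (_* (n * q ^ d)) (sym (𝟙-yes (d ≤? g) d≤g)) ⟩
          𝟙 (d ≤? g) * (n * q ^ d)     ∎

    -- Σ_{d ∣ n} d E_d = q^n with nB_n ≤ 2 q^⌊n/2⌋: the term n E_n carries all of q^n up to O(q^⌊n/2⌋).
    <c*E : ∀ n X α c → 1 ≤ n → X ≤ α * q ^ ⌊ n /2⌋ → n * α + 2 * c < c * q ^ ⌈ n /2⌉ → X < c * E n
    <c*E n X α c 1≤n X≤ dominant =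
      ℕ.*-cancelˡ-< n X (c * E n) (ℕ.+-cancelʳ-< (c * nBₑ n) (n * X) (n * (c * E n)) (begin-strict
        n * X + c * nBₑ n            ≤⟨ ℕ.+-mono-≤ (ℕ.*-monoʳ-≤ n X≤) (ℕ.*-monoʳ-≤ c (nB≤ n 1≤n)) ⟩
        n * (α * Q) + c * (2 * Q)    ≡⟨ factor n α c Q ⟩
        (n * α + 2 * c) * Q          <⟨ ℕ.*-monoˡ-< Q {{ℕ.m^n≢0 q ⌊ n /2⌋}} dominant ⟩
        (c * q ^ ⌈ n /2⌉) * Q        ≡⟨ ℕ.*-assoc c _ Q ⟩
        c * (q ^ ⌈ n /2⌉ * Q)        ≡⟨ cong (c *_) (q^⌈n/2⌉*q^⌊n/2⌋≡q^n n) ⟩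
        c * q ^ n                    ≡⟨ cong (c *_) (sym (divisorSum n 1≤n)) ⟩
        c * (nBₑ n + n * E n)        ≡⟨ distribute c (nBₑ n) n (E n) ⟩
        n * (c * E n) + c * nBₑ n    ∎))
      where
      open ℕ.≤-Reasoning
      Q : ℕ
      Q = q ^ ⌊ n /2⌋
      factor : ∀ n α c Q → n * (α * Q) + c * (2 * Q) ≡ (n * α + 2 * c) * Q
      factor = solve-∀
      distribute : ∀ c b n e → c * (b + n * e) ≡ n * (c * e) + c * b
      distribute = solve-∀

    2A+4<E-large : ∀ n → 3 ≤ n → 6 ≤ q → 2 * Aₑ n + 4 < E n
    2A+4<E-large n 3≤n 6≤q = subst (2 * Aₑ n + 4 <_) (ℕ.*-identityˡ (E n)) (<c*E n (2 * Aₑ n + 4) 8 1 1≤n X≤ dominant)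
      where
      open ℕ.≤-Reasoning
      1≤n : 1 ≤ n
      1≤n = ℕ.≤-trans (s≤s z≤n) 3≤n
      X≤ : 2 * Aₑ n + 4 ≤ 8 * q ^ ⌊ n /2⌋
      X≤ = begin
        2 * Aₑ n + 4                            ≤⟨ ℕ.+-mono-≤ (ℕ.*-monoʳ-≤ 2 (ℕ.≤-trans (A≤nB n) (nB≤ n 1≤n))) (ℕ.*-monoʳ-≤ 4 (ℕ.m^n>0 q ⌊ n /2⌋)) ⟩
        2 * (2 * q ^ ⌊ n /2⌋) + 4 * q ^ ⌊ n /2⌋  ≡⟨ collect (q ^ ⌊ n /2⌋) ⟩
        8 * q ^ ⌊ n /2⌋                         ∎
        where
        collect : ∀ Q → 2 * (2 * Q) + 4 * Q ≡ 8 * Q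
        collect = solve-∀
      36≤1*q² : 36 ≤ 1 * q ^ 2
      36≤1*q² = ℕ.≤-trans (ℕ.^-monoˡ-≤ 2 6≤q) (ℕ.≤-reflexive (sym (ℕ.*-identityˡ _)))
      dominant : n * 8 + 2 * 1 < 1 * q ^ ⌈ n /2⌉
      dominant = begin-strict
        n * 8 + 2 * 1             ≤⟨ ℕ.+-monoˡ-≤ 2 (ℕ.*-monoˡ-≤ 8 (n≤2*⌈n/2⌉ n)) ⟩
        2 * ⌈ n /2⌉ * 8 + 2       ≡⟨ reorder ⌈ n /2⌉ ⟩
        16 * ⌈ n /2⌉ + 2          <⟨ linear<exponential 16 2 1 q ⌈ n /2⌉ 2≤q (ℕ.⌈n/2⌉-mono 3≤n)
                                       (ℕ.≤-trans (ℕ.m≤m+n 16 20) 36≤1*q²) (ℕ.≤-trans (ℕ.m≤m+n 35 1) 36≤1*q²) ⟩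
        1 * q ^ ⌈ n /2⌉           ∎
        where
        reorder : ∀ u → 2 * u * 8 + 2 ≡ 16 * u + 2
        reorder = solve-∀

    402A+100q+200<98E-large : ∀ n → 3 ≤ n → 12 ≤ q → 402 * Aₑ n + 100 * q + 200 < 98 * E n
    402A+100q+200<98E-large n 3≤n 12≤q = <c*E n (402 * Aₑ n + 100 * q + 200) 1104 98 1≤n X≤ dominant
      where
      open ℕ.≤-Reasoning
      1≤n : 1 ≤ n
      1≤n = ℕ.≤-trans (s≤s z≤n) 3≤n
      Q : ℕ
      Q = q ^ ⌊ n /2⌋
      X≤ : 402 * Aₑ n + 100 * q + 200 ≤ 1104 * Q
      X≤ = begin
        402 * Aₑ n + 100 * q + 200           ≤⟨ ℕ.+-mono-≤ (ℕ.+-mono-≤ (ℕ.*-monoʳ-≤ 402 (ℕ.≤-trans (A≤nB n) (nB≤ n 1≤n)))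
                                                                      (ℕ.*-monoʳ-≤ 100 q≤Q))
                                                         (ℕ.*-monoʳ-≤ 200 (ℕ.m^n>0 q ⌊ n /2⌋)) ⟩
        402 * (2 * Q) + 100 * Q + 200 * Q    ≡⟨ collect Q ⟩
        1104 * Q                             ∎
        where
        q≤Q : q ≤ Q
        q≤Q = subst (_≤ Q) (ℕ.*-identityʳ q) (ℕ.^-monoʳ-≤ q (ℕ.⌊n/2⌋-mono 3≤n))
        collect : ∀ Q → 402 * (2 * Q) + 100 * Q + 200 * Q ≡ 1104 * Q
        collect = solve-∀
      144≤q² : 144 ≤ q ^ 2
      144≤q² = ℕ.^-monoˡ-≤ 2 12≤q
      dominant : n * 1104 + 2 * 98 < 98 * q ^ ⌈ n /2⌉
      dominant = begin-strict
        n * 1104 + 2 * 98         ≤⟨ ℕ.+-monoˡ-≤ 196 (ℕ.*-monoˡ-≤ 1104 (n≤2*⌈n/2⌉ n)) ⟩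
        2 * ⌈ n /2⌉ * 1104 + 196  ≡⟨ reorder ⌈ n /2⌉ ⟩
        2208 * ⌈ n /2⌉ + 196      <⟨ linear<exponential 2208 196 98 q ⌈ n /2⌉ 2≤q (ℕ.⌈n/2⌉-mono 3≤n)
                                       (ℕ.≤-trans (ℕ.m≤m+n 2208 11904) (ℕ.*-monoʳ-≤ 98 144≤q²))
                                       (ℕ.≤-trans (ℕ.m≤m+n 4613 9499) (ℕ.*-monoʳ-≤ 98 144≤q²)) ⟩
        98 * q ^ ⌈ n /2⌉          ∎
        where
        reorder : ∀ u → 2 * u * 1104 + 196 ≡ 2208 * u + 196
        reorder = solve-∀

    E₁≡q : E 1 ≡ q
    E₁≡q = trans (sym (ℕ.*-identityˡ (E 1))) (trans (divisorSum 1 ℕ.≤-refl) (ℕ.*-identityʳ q))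

    2E₂+q≡q² : 2 * E 2 + q ≡ q * q
    2E₂+q≡q² = begin
      2 * E 2 + q          ≡⟨ ℕ.+-comm (2 * E 2) q ⟩
      q + 2 * E 2          ≡⟨ cong (_+ 2 * E 2) (sym (trans (ℕ.+-identityʳ _) (trans (ℕ.*-identityˡ (E 1)) E₁≡q))) ⟩
      nBₑ 2 + 2 * E 2      ≡⟨ divisorSum 2 (s≤s z≤n) ⟩
      q * (q * 1)          ≡⟨ cong (q *_) (ℕ.*-identityʳ q) ⟩
      q * q                ∎
      where open ≡-Reasoning

    2A+4<E : 7 ≤ q → ∀ n → 1 ≤ n → 2 * Aₑ n + 4 < E n
    2A+4<E 7≤q 1 _ = subst (4 <_) (sym E₁≡q) (ℕ.≤-trans (ℕ.m≤m+n 5 2) 7≤q)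
    2A+4<E 7≤q 2 _ = subst (λ a → 2 * a + 4 < E 2) (sym (trans (ℕ.+-identityʳ _) E₁≡q)) (2q+4<E₂ q (E 2) 7≤q 2E₂+q≡q²)
    2A+4<E 7≤q n@(suc (suc (suc _))) _ = 2A+4<E-large n (s≤s (s≤s (s≤s z≤n))) (ℕ.≤-trans (ℕ.n≤1+n 6) 7≤q)

    100[4A+q+2]+2[A+E]<100E : 12 ≤ q → ∀ n → 1 < n → 100 * (4 * Aₑ n + q + 2) + 2 * (Aₑ n + E n) < 100 * E n
    100[4A+q+2]+2[A+E]<100E _ 1 (s≤s ())
    100[4A+q+2]+2[A+E]<100E 12≤q 2 _ = subst (λ a → 100 * (4 * a + q + 2) + 2 * (a + E 2) < 100 * E 2) (sym (trans (ℕ.+-identityʳ _) E₁≡q))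
                              (100[4q+q+2]+2[q+e]<100e q (E 2) 12≤q 2E₂+q≡q²)
    100[4A+q+2]+2[A+E]<100E 12≤q n@(suc (suc (suc _))) _ = subst₂ _<_ (sym (expandˡ (Aₑ n) q (E n))) (sym (expandʳ (E n)))
                                                  (ℕ.+-monoˡ-< (2 * E n) (402A+100q+200<98E-large n (s≤s (s≤s (s≤s z≤n))) 12≤q))
      where
      expandˡ : ∀ a q e → 100 * (4 * a + q + 2) + 2 * (a + e) ≡ (402 * a + 100 * q + 200) + 2 * e
      expandˡ = solve-∀
      expandʳ : ∀ e → 100 * e ≡ 98 * e + 2 * e
      expandʳ = solve-∀

    n*A²≤ : ∀ n → 1 ≤ n → (n * Aₑ n) ^ 2 ≤ 12 ^ 2 * q ^ n
    n*A²≤ n 1≤n = square≤ (n * Aₑ n) 12 q n (n*A≤ n 1≤n)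

    nB²≤ : ∀ n → 1 ≤ n → nBₑ n ^ 2 ≤ 2 ^ 2 * q ^ n
    nB²≤ n 1≤n = square≤ (nBₑ n) 2 q n (nB≤ n 1≤n)

    -- q^n - n E_n is exactly nB_n, and n E_n never exceeds q^n.
    nE-q^n²≤ : ∀ n → 1 ≤ n → ((q ^ n ∸ n * E n) ^ 2 ≤ 2 ^ 2 * q ^ n) × ((n * E n ∸ q ^ n) ^ 2 ≤ 2 ^ 2 * q ^ n)
    nE-q^n²≤ n 1≤n = subst (λ z → z ^ 2 ≤ 2 ^ 2 * q ^ n) (sym q^n∸nE≡nB) (nB²≤ n 1≤n) ,
                     subst (λ z → z ^ 2 ≤ 2 ^ 2 * q ^ n) (sym nE∸q^n≡0) z≤n
      where
      q^n∸nE≡nB : q ^ n ∸ n * E n ≡ nBₑ n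
      q^n∸nE≡nB = trans (cong (_∸ n * E n) (sym (divisorSum n 1≤n))) (ℕ.m+n∸n≡m (nBₑ n) (n * E n))
      nE∸q^n≡0 : n * E n ∸ q ^ n ≡ 0
      nE∸q^n≡0 = ℕ.m≤n⇒m∸n≡0 (subst (n * E n ≤_) (divisorSum n 1≤n) (ℕ.m≤n+m _ _))

gauss-formula : (F : FiniteField) (n : ℕ) → 1 ≤ n → nB F n + n * E F n ≡ card F ^ n
gauss-formula F (suc n) _ = trans (sym (divisorSum≡ (card F) (E F) (suc n) (s≤s z≤n)))
                          (degreeIdentity⇒divisorSum (card F) (E F) (Counting.∑-degree-powerMultiples F) n)

module Estimates (F : FiniteField) where
  open Bounds (card F) (FieldOrder.2≤size F) (E F) public

lemma2p13 :
    ((F : FiniteField) (n : ℕ) → 1 ≤ n → nB F n + n * E F n ≡ card F ^ n)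
    × (Σ ℕ λ C → (F : FiniteField) (n : ℕ) → 1 ≤ n →
         (n * A F n) ^ 2 ≤ C ^ 2 * card F ^ n)
    × (Σ ℕ λ C → (F : FiniteField) (n : ℕ) → 1 ≤ n →
         nB F n ^ 2 ≤ C ^ 2 * card F ^ n)
    × (Σ ℕ λ C → (F : FiniteField) (n : ℕ) → 1 ≤ n →
         ((card F ^ n ∸ n * E F n) ^ 2 ≤ C ^ 2 * card F ^ n)
         × ((n * E F n ∸ card F ^ n) ^ 2 ≤ C ^ 2 * card F ^ n))
    × ((F : FiniteField) (n : ℕ) → 1 ≤ n → 5 < card F →
         2 * A F n + 4 < E F n)
    × (Σ ℕ λ m → (1 ≤ m) × ((F : FiniteField) (n : ℕ) → 11 < card F → 1 < n →
         m * (4 * A F n + card F + 2) + 2 * (A F n + E F n) < m * E F n))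
lemma2p13 =
    gauss-formula
  , (12 , λ F → Estimates.n*A²≤ F (gauss-formula F))
  , (2 , λ F → Estimates.nB²≤ F (gauss-formula F))
  , (2 , λ F → Estimates.nE-q^n²≤ F (gauss-formula F))
  , (λ F n 1≤n 5<q → Estimates.2A+4<E F (gauss-formula F) (FieldOrder.5<size⇒7≤size F 5<q) n 1≤n)
  , (100 , s≤s z≤n , λ F n 11<q 1<n → Estimates.100[4A+q+2]+2[A+E]<100E F (gauss-formula F) 11<q n 1<n)
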